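{- As rational functions on the configuration space $X(k,n)$, $$\prod_{J\in\binom{[n]}{k}^{\mathrm{ncyc}}}u_J=\prod_{j=0}^{n-1}\frac{p_{\mathrm{cyc}(j)}}{p_{\mathrm{gap}(j)}}.$$ Consequently, the linear functional $H(\pi)=\sum_{j=0}^{n-1}(\pi_{\mathrm{cyc}(j)}-\pi_{\mathrm{gap}(j)})$ on $\mathbb{R}^{\binom{[n]}{k}}$ satisfies $$H=\sum_{J\in\binom{[n]}{k}^{\mathrm{ncyc}}}u^t_J.$$
   Context: Fix $2\le k<n$, with indices mod $n$. A $k$-subset is cyclic if it is $\{a,\dots,a+k-1\}$ (mod $n$); $\binom{[n]}{k}^{\mathrm{ncyc}}$ is the set of non-cyclic $k$-subsets. Let $p_I$ be the Plücker coordinates. Cyclic and gap intervals. For $j\in\{0,\dots,n-1\}$, $\mathrm{cyc}(j)=\{j+1,\dots,j+k\}$ and $\mathrm{gap}(j)=\{j+1,\dots,j+k-1,j+k+1\}$ (mod $n$). Planar cross-ratios. For $J\in\binom{[n]}{k}$, let $I_J=\{j\in J:j+1\notin J\}$. The cubical array $C_J$ is the set of $k$-subsets $M$ with $e_M=e_J+\sum_{m\in A}(e_{m+1}-e_m)$ for some $A\subseteq I_J$, where $e_S=\sum_{s\in S}e_s$. Then $$u_J=\prod_{M\in C_J}p_M^{(-1)^{|J\cap M|-k-1}}$$ and its tropicalization is the linear functional $u^t_J(\pi)=\sum_{M\in C_J}(-1)^{|J\cap M|-k-1}\pi_M$ on $\mathbb{R}^{\binom{[n]}{k}}$. -}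

module Defs where

open import Data.Bool using (Bool; true; false; if_then_else_; _∧_; _∨_; not)
open import Data.Nat using (ℕ; zero; suc)
import Data.Nat as ℕ
open import Data.Nat.DivMod using (_mod_)
open import Data.Fin using (Fin; toℕ)
open import Data.Fin.Properties using (all?; any?)
open import Data.Fin.Subset using (Subset; ⁅_⁆; _∪_; _∩_; ∣_∣; _⊆_)
open import Data.Fin.Subset.Properties using (_⊆?_)
open import Data.Vec using (Vec; []; _∷_; lookup; tabulate)
import Data.Vec.Properties as VecP
open import Data.List using (List; []; _∷_; map; concatMap; filter; foldr; _++_; upTo; allFin)
open import Data.List.Relation.Unary.Any using (Any)
import Data.List.Relation.Unary.Any as Any
open import Data.Integer using (ℤ; +_; _+_; _-_; _*_; -1ℤ; _^_)
import Data.Integer as ℤ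
open import Data.Product using (Σ; ∃; _×_; _,_)
open import Relation.Binary.PropositionalEquality using (_≡_)
open import Relation.Nullary using (¬_; Dec)
open import Relation.Nullary.Decidable using (_×-dec_; ¬?)
import Data.Bool.Properties as BoolP
open import Algebra.Bundles using (AbelianGroup)
import Data.Fin.Subset as FS

-- Ground set [n] is modelled by Fin n (labels 0,…,n-1); a subset is a
-- characteristic vector (Data.Fin.Subset).  Arithmetic on labels is mod n.

_⊕_ : ∀ {n} → Fin n → ℕ → Fin n
_⊕_ {zero} () a
_⊕_ {suc m} i a = (toℕ i ℕ.+ a) mod (suc m)

_∈ᵇ_ : ∀ {n} → Fin n → Subset n → Bool
i ∈ᵇ S = lookup S i

ofList : ∀ {n} → List (Fin n) → Subset n
ofList = foldr (λ i S → ⁅ i ⁆ ∪ S) FS.⊥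

allSubsets : (n : ℕ) → List (Subset n)
allSubsets zero = [] ∷ []
allSubsets (suc n) = concatMap (λ S → (FS.outside ∷ S) ∷ (FS.inside ∷ S) ∷ []) (allSubsets n)

kSubsets : (n k : ℕ) → List (Subset n)
kSubsets n k = filter (λ S → ∣ S ∣ ℕ.≟ k) (allSubsets n)

interval : ∀ {n} → ℕ → Fin n → Subset n
interval k a = ofList (map (a ⊕_) (upTo k))

IsCyclic : ∀ {n} → ℕ → Subset n → Set
IsCyclic k S = ∃ λ a → S ≡ interval k a

isCyclic? : ∀ {n} (k : ℕ) (S : Subset n) → Dec (IsCyclic k S)
isCyclic? k S = any? (λ a → VecP.≡-dec BoolP._≟_ S (interval k a))

nonCyclic : (n k : ℕ) → List (Subset n)
nonCyclic n k = filter (λ S → ¬? (isCyclic? k S)) (kSubsets n k)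

cyc : ∀ {n} → ℕ → Fin n → Subset n
cyc k j = ofList (map (λ t → j ⊕ suc t) (upTo k))

gap : ∀ {n} → ℕ → Fin n → Subset n
gap k j = ofList (map (λ t → j ⊕ suc t) (upTo (k ℕ.∸ 1)) ++ (j ⊕ (k ℕ.+ 1)) ∷ [])

IJ : ∀ {n} → Subset n → Subset n
IJ J = tabulate (λ j → (j ∈ᵇ J) ∧ not ((j ⊕ 1) ∈ᵇ J))

e : ∀ {n} → Subset n → Fin n → ℤ
e S i = if i ∈ᵇ S then + 1 else + 0

δ : ∀ {n} → Fin n → Fin n → ℤ
δ m i = e ⁅ m ⁆ i

sumℤ : List ℤ → ℤ
sumℤ = foldr _+_ (+ 0)

cubeVec : ∀ {n} → Subset n → Subset n → Fin n → ℤ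
cubeVec {n} J A i =
  e J i + sumℤ (map (λ m → if m ∈ᵇ A then δ (m ⊕ 1) i - δ m i else + 0) (allFin n))

InCube : ∀ {n} → Subset n → Subset n → Set
InCube {n} J M = Any (λ A → (A ⊆ IJ J) × (∀ i → e M i ≡ cubeVec J A i)) (allSubsets n)

inCube? : ∀ {n} (J M : Subset n) → Dec (InCube J M)
inCube? {n} J M = Any.any? (λ A → (A ⊆? IJ J) ×-dec all? (λ i → e M i ℤ.≟ cubeVec J A i)) (allSubsets n)

cube : (n k : ℕ) → Subset n → List (Subset n)
cube n k J = filter (λ M → inCube? J M) (kSubsets n k)

-- the sign (-1)^{|J∩M|-k-1}; since (-1)^m depends only on the parity of m,
-- and |J∩M|-k-1 ≡ |J∩M|+k+1 (mod 2), we use the natural exponent |J∩M|+k+1.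
sgn : ∀ {n} → ℕ → Subset n → Subset n → ℤ
sgn k J M = -1ℤ ^ (∣ J ∩ M ∣ ℕ.+ k ℕ.+ 1)

ut : (n k : ℕ) → Subset n → (Subset n → ℤ) → ℤ
ut n k J π = sumℤ (map (λ M → sgn k J M * π M) (cube n k J))

H : (n k : ℕ) → (Subset n → ℤ) → ℤ
H n k π = sumℤ (map (λ j → π (cyc k j) - π (gap k j)) (allFin n))

-- Multiplicative version in an abelian group (formal Laurent monomials).
module _ {c ℓ} (G : AbelianGroup c ℓ) where
  open AbelianGroup G renaming (_∙_ to _·_; ε to 1G; _⁻¹ to inv)

  prodG : List Carrier → Carrier
  prodG = foldr _·_ 1G

  powN : Carrier → ℕ → Carrier
  powN x zero = 1G
  powN x (suc m) = x · powN x m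

  powZ : Carrier → ℤ → Carrier
  powZ x (+ m) = powN x m
  powZ x (ℤ.-[1+ m ]) = inv (powN x (suc m))

  uG : (n k : ℕ) → (Subset n → Carrier) → Subset n → Carrier
  uG n k p J = prodG (map (λ M → powZ (p M) (sgn k J M)) (cube n k J))

  rhsG : (n k : ℕ) → (Subset n → Carrier) → Carrier
  rhsG n k p = prodG (map (λ j → p (cyc k j) · inv (p (gap k j))) (allFin n))

-- Both sides are monomials ∏_M p_M ^ a(M) over all subsets M, so it suffices to compare exponents.
-- Membership M ∈ C_J is a local condition on consecutive positions, because the set A of the
-- definition is forced to be J ∖ M. Fix a k-subset M and some b ∈ M with b − 1 ∉ M: toggling b − 1
-- and b in J preserves |J| and M ∈ C_J but changes |J ∩ M| by one, so the signed count of all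
-- k-subsets J with M ∈ C_J vanishes. Hence the exponent of p_M on the left is minus the signed count
-- over the cyclic J = cyc(j). For those, I_J is the single right end j + k, so C_J = {cyc(j), gap(j)}
-- with signs −1 and +1, which is the exponent of p_M on the right. The tropical identity is the case
-- of the additive group ℤ.

module Submission where

open import Defs
open import Algebra.Bundles using (AbelianGroup)
open import Data.Bool using (Bool; true; false; if_then_else_; _∧_; _∨_; not)
import Data.Bool.Properties as Bool
open import Data.Fin using (Fin; toℕ)
import Data.Fin as Fin
import Data.Fin.Properties as Fin
open import Data.Fin.Subset using (Subset; ⁅_⁆; _∪_; _∩_; _─_; ∣_∣; _⊆_)
import Data.Fin.Subset as Subset
import Data.Fin.Subset.Properties as Subset
open import Data.Integer using (ℤ; +_; -[1+_]; _⊖_; _+_; _-_; _*_; -_; -1ℤ)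
import Data.Integer as ℤ
import Data.Integer.Properties as ℤ
import Algebra.Properties.AbelianGroup ℤ.+-0-abelianGroup as ℤ-AbelianGroup
open import Data.List using (List; []; _∷_; map; filter; concatMap; _++_; allFin; upTo)
import Data.List.Properties as List
open import Data.List.Relation.Unary.Any using (Any; here; there)
import Data.List.Relation.Unary.Any as Any
open import Data.List.Relation.Unary.Any.Properties using (concatMap⁺)
open import Data.Nat using (ℕ; zero; suc; _<_; _≤_; _%_; z≤n; s≤s)
import Data.Nat as ℕ
import Data.Nat.Properties as ℕ
import Data.Nat.DivMod as ℕ
open import Data.Product using (∃; _×_; _,_; proj₁; proj₂)
open import Data.Sum using (_⊎_; inj₁; inj₂)
open import Data.Vec using ([]; _∷_; lookup; updateAt)
import Data.Vec.Properties as Vec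
open import Function using (_∘_; _⇔_; mk⇔; Equivalence)
open import Function.Definitions using (Injective)
open import Level using (0ℓ)
open import Relation.Binary.Definitions using (DecidableEquality; tri<; tri≈; tri>)
open import Relation.Binary.PropositionalEquality as ≡ using (_≡_; _≢_)
open import Relation.Nullary using (Dec; yes; no; does; ¬_; contradiction)
open import Relation.Nullary.Decidable using (dec-true; dec-false; does-⇔; ¬?)
open import Relation.Unary using (Pred; Decidable)

module ListProduct {c ℓ} (G : AbelianGroup c ℓ) where
  open AbelianGroup G renaming (_∙_ to _·_; ε to 1G; _⁻¹ to inv)
  open import Relation.Binary.Reasoning.Setoid setoid
  open import Algebra.Properties.CommutativeSemigroup commutativeSemigroup using (interchange)
  open import Algebra.Properties.AbelianGroup G using (⁻¹-∙-comm)
  open import Algebra.Properties.Group group using (ε⁻¹≈ε; ⁻¹-involutive)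

  ∏ : {A : Set} → (A → Carrier) → List A → Carrier
  ∏ f xs = prodG G (map f xs)

  ∏-cong : {A : Set} {f g : A → Carrier} (xs : List A) → (∀ x → f x ≈ g x) → ∏ f xs ≈ ∏ g xs
  ∏-cong []       f≈g = refl
  ∏-cong (x ∷ xs) f≈g = ∙-cong (f≈g x) (∏-cong xs f≈g)

  ∏-1 : {A : Set} {f : A → Carrier} (xs : List A) → (∀ x → f x ≈ 1G) → ∏ f xs ≈ 1G
  ∏-1 []       f≈1 = refl
  ∏-1 (x ∷ xs) f≈1 = trans (∙-cong (f≈1 x) (∏-1 xs f≈1)) (identityˡ 1G)

  ∏-· : {A : Set} (f g : A → Carrier) (xs : List A) → ∏ (λ x → f x · g x) xs ≈ ∏ f xs · ∏ g xs
  ∏-· f g []       = sym (identityˡ 1G)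
  ∏-· f g (x ∷ xs) = trans (∙-congˡ (∏-· f g xs)) (interchange _ _ _ _)

  ∏-inv : {A : Set} (f : A → Carrier) (xs : List A) → inv (∏ f xs) ≈ ∏ (λ x → inv (f x)) xs
  ∏-inv f []       = ε⁻¹≈ε
  ∏-inv f (x ∷ xs) = trans (sym (⁻¹-∙-comm (f x) (∏ f xs))) (∙-congˡ (∏-inv f xs))

  ∏-swap : {A B : Set} (g : A → B → Carrier) (xs : List A) (ys : List B) →
    ∏ (λ x → ∏ (g x) ys) xs ≈ ∏ (λ y → ∏ (λ x → g x y) xs) ys
  ∏-swap g []       ys = sym (∏-1 ys (λ _ → refl))
  ∏-swap g (x ∷ xs) ys = trans (∙-congˡ (∏-swap g xs ys)) (sym (∏-· (g x) _ ys))

  ∏-filter : {A : Set} {P : Pred A 0ℓ} (P? : Decidable P) (f : A → Carrier) (xs : List A) →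
    ∏ f (filter P? xs) ≈ ∏ (λ x → if does (P? x) then f x else 1G) xs
  ∏-filter P? f []       = refl
  ∏-filter P? f (x ∷ xs) with does (P? x)
  ... | true  = ∙-congˡ (∏-filter P? f xs)
  ... | false = trans (∏-filter P? f xs) (sym (identityˡ _))

  ∏-++ : {A : Set} (f : A → Carrier) (xs ys : List A) → ∏ f (xs ++ ys) ≈ ∏ f xs · ∏ f ys
  ∏-++ f []       ys = sym (identityˡ _)
  ∏-++ f (x ∷ xs) ys = trans (∙-congˡ (∏-++ f xs ys)) (sym (assoc _ _ _))

  ∏-concatMap : {A B : Set} (f : B → Carrier) (g : A → List B) (xs : List A) →
    ∏ f (concatMap g xs) ≈ ∏ (λ x → ∏ f (g x)) xs
  ∏-concatMap f g []       = refl
  ∏-concatMap f g (x ∷ xs) = trans (∏-++ f (g x) (concatMap g xs)) (∙-congˡ (∏-concatMap f g xs))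

  _^_ : Carrier → ℤ → Carrier
  _^_ = powZ G

  powN-+ : ∀ x m n → powN G x (m ℕ.+ n) ≈ powN G x m · powN G x n
  powN-+ x zero    n = sym (identityˡ _)
  powN-+ x (suc m) n = trans (∙-congˡ (powN-+ x m n)) (sym (assoc _ _ _))

  ^-⊖ : ∀ x m n → x ^ (m ⊖ n) ≈ powN G x m · inv (powN G x n)
  ^-⊖ x m zero = begin
    x ^ (m ⊖ 0)              ≡⟨ ≡.cong (x ^_) (ℤ.⊖-≥ {m} {0} ℕ.z≤n) ⟩
    powN G x m               ≈⟨ sym (identityʳ _) ⟩
    powN G x m · 1G          ≈⟨ ∙-congˡ (sym ε⁻¹≈ε) ⟩
    powN G x m · inv 1G      ∎
  ^-⊖ x zero (suc n) = begin
    x ^ (0 ⊖ suc n)          ≡⟨ ≡.cong (x ^_) (ℤ.⊖-< {0} {suc n} (ℕ.s≤s ℕ.z≤n)) ⟩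
    inv (powN G x (suc n))   ≈⟨ sym (identityˡ _) ⟩
    1G · inv (powN G x (suc n)) ∎
  ^-⊖ x (suc m) (suc n) = begin
    x ^ (suc m ⊖ suc n)                              ≡⟨ ≡.cong (x ^_) (ℤ.[1+m]⊖[1+n]≡m⊖n m n) ⟩
    x ^ (m ⊖ n)                                      ≈⟨ ^-⊖ x m n ⟩
    powN G x m · inv (powN G x n)                    ≈⟨ sym (identityˡ _) ⟩
    1G · (powN G x m · inv (powN G x n))             ≈⟨ ∙-congʳ (sym (inverseʳ x)) ⟩
    (x · inv x) · (powN G x m · inv (powN G x n))    ≈⟨ interchange _ _ _ _ ⟩
    (x · powN G x m) · (inv x · inv (powN G x n))    ≈⟨ ∙-congˡ (⁻¹-∙-comm _ _) ⟩
    (x · powN G x m) · inv (x · powN G x n)          ∎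

  ^-+ : ∀ x a b → x ^ (a + b) ≈ x ^ a · x ^ b
  ^-+ x (+ m)    (+ n)    = powN-+ x m n
  ^-+ x (+ m)    -[1+ n ] = ^-⊖ x m (suc n)
  ^-+ x -[1+ m ] (+ n)    = trans (^-⊖ x n (suc m)) (comm _ _)
  ^-+ x -[1+ m ] -[1+ n ] = begin
    inv (powN G x (suc (suc m ℕ.+ n)))               ≡⟨ ≡.cong (λ t → inv (powN G x (suc t))) (≡.sym (ℕ.+-suc m n)) ⟩
    inv (powN G x (suc m ℕ.+ suc n))                 ≈⟨ ⁻¹-cong (powN-+ x (suc m) (suc n)) ⟩
    inv (powN G x (suc m) · powN G x (suc n))        ≈⟨ sym (⁻¹-∙-comm _ _) ⟩
    inv (powN G x (suc m)) · inv (powN G x (suc n))  ∎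

  ^-neg : ∀ x a → x ^ (- a) ≈ inv (x ^ a)
  ^-neg x (+ zero)  = sym ε⁻¹≈ε
  ^-neg x (+ suc m) = refl
  ^-neg x -[1+ m ]  = sym (⁻¹-involutive _)

  ∏-^ : {A : Set} (x : Carrier) (a : A → ℤ) (xs : List A) → ∏ (λ y → x ^ a y) xs ≈ x ^ sumℤ (map a xs)
  ∏-^ x a []       = refl
  ∏-^ x a (y ∷ xs) = trans (∙-congˡ (∏-^ x a xs)) (sym (^-+ x (a y) _))

module ℤ-Sum = ListProduct ℤ.+-0-abelianGroup
open ℤ-Sum using ()
  renaming (∏ to ∑; ∏-cong to ∑-cong; ∏-1 to ∑-0; ∏-· to ∑-+; ∏-inv to ∑-neg; ∏-swap to ∑-swap;
            ∏-concatMap to ∑-concatMap)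

∑-*ʳ : {A : Set} (f : A → ℤ) (c : ℤ) (xs : List A) → ∑ (λ x → f x * c) xs ≡ ∑ f xs * c
∑-*ʳ f c []       = ≡.refl
∑-*ʳ f c (x ∷ xs) = ≡.trans (≡.cong (_+_ (f x * c)) (∑-*ʳ f c xs)) (≡.sym (ℤ.*-distribʳ-+ c (f x) (∑ f xs)))

i≡-i⇒i≡0 : ∀ i → i ≡ - i → i ≡ + 0
i≡-i⇒i≡0 (+ zero)  _ = ≡.refl
i≡-i⇒i≡0 (+ suc n) ()
i≡-i⇒i≡0 -[1+ n ]  ()

-1ℤ^-double : ∀ x → -1ℤ ℤ.^ (x ℕ.+ x) ≡ + 1
-1ℤ^-double zero    = ≡.refl
-1ℤ^-double (suc x) = begin
  -1ℤ ℤ.^ suc (x ℕ.+ suc x)       ≡⟨ ≡.cong (λ t → -1ℤ ℤ.^ suc t) (ℕ.+-suc x x) ⟩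
  -1ℤ * (-1ℤ * -1ℤ ℤ.^ (x ℕ.+ x))  ≡⟨ ≡.cong (λ t → -1ℤ * (-1ℤ * t)) (-1ℤ^-double x) ⟩
  + 1                              ∎
  where open ≡.≡-Reasoning

∑-allFin-suc : ∀ {n} (g : Fin (suc n) → ℤ) → ∑ g (allFin (suc n)) ≡ g Fin.zero + ∑ (g ∘ Fin.suc) (allFin n)
∑-allFin-suc {n} g = ≡.cong (λ xs → g Fin.zero + sumℤ xs)
  (≡.trans (List.map-tabulate Fin.suc g) (≡.sym (List.map-tabulate (λ i → i) (g ∘ Fin.suc))))

bit : Bool → ℤ
bit b = if b then + 1 else + 0

bit-injective : ∀ {a b} → bit a ≡ bit b → a ≡ b
bit-injective {true}  {true}  _ = ≡.refl
bit-injective {false} {false} _ = ≡.refl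

𝟙 : {P : Set} → Dec P → ℤ
𝟙 P? = bit (does P?)

𝟙-yes : {P : Set} (P? : Dec P) → P → 𝟙 P? ≡ + 1
𝟙-yes P? p = ≡.cong bit (dec-true P? p)

𝟙-no : {P : Set} (P? : Dec P) → ¬ P → 𝟙 P? ≡ + 0
𝟙-no P? ¬p = ≡.cong bit (dec-false P? ¬p)

𝟙-⇔ : {P Q : Set} → P ⇔ Q → (P? : Dec P) (Q? : Dec Q) → 𝟙 P? ≡ 𝟙 Q?
𝟙-⇔ P⇔Q P? Q? = ≡.cong bit (does-⇔ P⇔Q P? Q?)

guard : Bool → ℤ → ℤ
guard b x = if b then x else + 0

guard-0 : ∀ b → guard b (+ 0) ≡ + 0
guard-0 true  = ≡.refl
guard-0 false = ≡.refl

guard≡𝟙* : {P : Set} (P? : Dec P) (c : ℤ) → guard (does P?) c ≡ 𝟙 P? * c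
guard≡𝟙* P? c with does P?
... | true  = ≡.sym (ℤ.*-identityˡ c)
... | false = ≡.refl

Enumerates : {A : Set} → DecidableEquality A → List A → Set
Enumerates _≟_ xs = ∀ y → ∑ (λ x → 𝟙 (x ≟ y)) xs ≡ + 1

∑-δ : {A : Set} (_≟_ : DecidableEquality A) (xs : List A) → Enumerates _≟_ xs →
  ∀ y (g : A → ℤ) → ∑ (λ x → guard (does (x ≟ y)) (g x)) xs ≡ g y
∑-δ _≟_ xs enum y g = begin
  ∑ (λ x → guard (does (x ≟ y)) (g x)) xs          ≡⟨ ∑-cong xs δ≡𝟙* ⟩
  ∑ (λ x → 𝟙 (x ≟ y) * g y) xs                   ≡⟨ ∑-*ʳ _ (g y) xs ⟩
  ∑ (λ x → 𝟙 (x ≟ y)) xs * g y                   ≡⟨ ≡.cong (_* g y) (enum y) ⟩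
  + 1 * g y                                      ≡⟨ ℤ.*-identityˡ (g y) ⟩
  g y                                              ∎
  where
  open ≡.≡-Reasoning
  δ≡𝟙* : ∀ x → guard (does (x ≟ y)) (g x) ≡ 𝟙 (x ≟ y) * g y
  δ≡𝟙* x with x ≟ y
  ... | yes ≡.refl = ≡.sym (ℤ.*-identityˡ (g x))
  ... | no _       = ≡.refl

allFin-enumerates : ∀ n → Enumerates (Fin._≟_ {n}) (allFin n)
allFin-enumerates (suc n) Fin.zero = begin
  ∑ (λ x → 𝟙 (x Fin.≟ Fin.zero)) (allFin (suc n))  ≡⟨ ∑-allFin-suc {n} (λ x → 𝟙 (x Fin.≟ Fin.zero)) ⟩
  + 1 + ∑ (λ _ → + 0) (allFin n)                   ≡⟨ ≡.cong (_+_ (+ 1)) (∑-0 (allFin n) (λ _ → ≡.refl)) ⟩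
  + 1                                              ∎
  where open ≡.≡-Reasoning
allFin-enumerates (suc n) (Fin.suc y) = begin
  ∑ (λ x → 𝟙 (x Fin.≟ Fin.suc y)) (allFin (suc n))
    ≡⟨ ∑-allFin-suc (λ x → 𝟙 (x Fin.≟ Fin.suc y)) ⟩
  + 0 + ∑ (λ x → 𝟙 (Fin.suc x Fin.≟ Fin.suc y)) (allFin n)
    ≡⟨ ℤ.+-identityˡ _ ⟩
  ∑ (λ x → 𝟙 (Fin.suc x Fin.≟ Fin.suc y)) (allFin n)
    ≡⟨ ∑-cong (allFin n) (λ x → 𝟙-⇔ suc≡suc⇔≡ (Fin.suc x Fin.≟ Fin.suc y) (x Fin.≟ y)) ⟩
  ∑ (λ x → 𝟙 (x Fin.≟ y)) (allFin n)
    ≡⟨ allFin-enumerates n y ⟩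
  + 1
    ∎
  where
  open ≡.≡-Reasoning
  suc≡suc⇔≡ : ∀ {x} → Fin.suc x ≡ Fin.suc y ⇔ x ≡ y
  suc≡suc⇔≡ = mk⇔ Fin.suc-injective (≡.cong Fin.suc)

_≟ˢ_ : ∀ {n} → DecidableEquality (Subset n)
_≟ˢ_ = Vec.≡-dec Bool._≟_

∑-allSubsets-suc : ∀ {n} (g : Subset (suc n) → ℤ) →
  ∑ g (allSubsets (suc n)) ≡ ∑ (λ S → g (false ∷ S) + g (true ∷ S)) (allSubsets n)
∑-allSubsets-suc {n} g = ≡.trans (∑-concatMap g _ (allSubsets n))
  (∑-cong (allSubsets n) (λ S → ≡.cong (_+_ (g (false ∷ S))) (ℤ.+-identityʳ (g (true ∷ S)))))

allSubsets-enumerates : ∀ n → Enumerates _≟ˢ_ (allSubsets n)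
allSubsets-enumerates zero    [] = ≡.refl
allSubsets-enumerates (suc n) (b ∷ T) =
  ≡.trans (∑-allSubsets-suc (λ S → 𝟙 (S ≟ˢ (b ∷ T))))
          (≡.trans (∑-cong (allSubsets n) (count-heads b)) (allSubsets-enumerates n T))
  where
  count-heads : ∀ b S → 𝟙 ((false ∷ S) ≟ˢ (b ∷ T)) + 𝟙 ((true ∷ S) ≟ˢ (b ∷ T)) ≡ 𝟙 (S ≟ˢ T)
  count-heads b S with does (S ≟ˢ T)
  count-heads false S | true  = ≡.refl
  count-heads true  S | true  = ≡.refl
  count-heads false S | false = ≡.refl
  count-heads true  S | false = ≡.refl

𝟙-image : ∀ {n} {A P : Set} (_≟_ : DecidableEquality A) {φ : Fin n → A} → Injective _≡_ _≡_ φ →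
  ∀ x (P? : Dec P) → P ⇔ (∃ λ a → x ≡ φ a) → 𝟙 P? ≡ ∑ (λ a → 𝟙 (x ≟ φ a)) (allFin n)
𝟙-image {n} _≟_ {φ} φ-inj x P? P⇔image with P?
... | yes p = ≡.sym (≡.trans (∑-cong (allFin n) hit) (allFin-enumerates n a₀))
  where
  open Equivalence P⇔image
  a₀ = proj₁ (to p)
  hit : ∀ a → 𝟙 (x ≟ φ a) ≡ 𝟙 (a Fin.≟ a₀)
  hit a = 𝟙-⇔ (mk⇔ (λ x≡φa → φ-inj (≡.trans (≡.sym x≡φa) (proj₂ (to p)))) (λ { ≡.refl → proj₂ (to p) }))
              (x ≟ φ a) (a Fin.≟ a₀)
... | no ¬p = ≡.sym (∑-0 (allFin n) (λ a → 𝟙-no (x ≟ φ a) (λ x≡φa → ¬p (Equivalence.from P⇔image (a , x≡φa)))))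

lookup-ext : ∀ {n} {S T : Subset n} → (∀ x → lookup S x ≡ lookup T x) → S ≡ T
lookup-ext {S = S} {T} S≗T =
  ≡.trans (≡.sym (Vec.tabulate∘lookup S)) (≡.trans (Vec.tabulate-cong S≗T) (Vec.tabulate∘lookup T))

lookup-⊥ : ∀ {n} (x : Fin n) → lookup Subset.⊥ x ≡ false
lookup-⊥ x = Vec.lookup-replicate x false

lookup-⁅⁆ : ∀ {n} (y x : Fin n) → lookup ⁅ y ⁆ x ≡ does (x Fin.≟ y)
lookup-⁅⁆ Fin.zero    Fin.zero    = ≡.refl
lookup-⁅⁆ Fin.zero    (Fin.suc x) = lookup-⊥ x
lookup-⁅⁆ (Fin.suc y) Fin.zero    = ≡.refl
-- Fin.suc x ≟ Fin.suc y is a map′ of x ≟ y, so its `does` only reduces once x ≟ y is abstracted.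
lookup-⁅⁆ (Fin.suc y) (Fin.suc x) with x Fin.≟ y | lookup-⁅⁆ y x
... | yes _ | x∈⁅y⁆ = x∈⁅y⁆
... | no _  | x∉⁅y⁆ = x∉⁅y⁆

lookup-∪ : ∀ {n} (S T : Subset n) x → lookup (S ∪ T) x ≡ lookup S x ∨ lookup T x
lookup-∪ S T x = Vec.lookup-zipWith _∨_ x S T

lookup-∩ : ∀ {n} (S T : Subset n) x → lookup (S ∩ T) x ≡ lookup S x ∧ lookup T x
lookup-∩ S T x = Vec.lookup-zipWith _∧_ x S T

lookup-─ : ∀ {n} (S T : Subset n) x → lookup (S ─ T) x ≡ lookup S x ∧ not (lookup T x)
lookup-─ (a ∷ S) (true ∷ T)  Fin.zero    = ≡.sym (Bool.∧-zeroʳ a)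
lookup-─ (a ∷ S) (false ∷ T) Fin.zero    = ≡.sym (Bool.∧-identityʳ a)
lookup-─ (a ∷ S) (b ∷ T)     (Fin.suc x) = lookup-─ S T x

lookup-ofList-∷ : ∀ {n} (y : Fin n) ys x → lookup (ofList (y ∷ ys)) x ≡ does (x Fin.≟ y) ∨ lookup (ofList ys) x
lookup-ofList-∷ y ys x = ≡.trans (lookup-∪ ⁅ y ⁆ (ofList ys) x) (≡.cong (_∨ lookup (ofList ys) x) (lookup-⁅⁆ y x))

lookup-ofList-[_] : ∀ {n} (y x : Fin n) → lookup (ofList (y ∷ [])) x ≡ does (x Fin.≟ y)
lookup-ofList-[ y ] x = ≡.trans (lookup-ofList-∷ y [] x) (≡.trans (≡.cong (does (x Fin.≟ y) ∨_) (lookup-⊥ x)) (Bool.∨-identityʳ _))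

lookup-ofList-++ : ∀ {n} (xs ys : List (Fin n)) x →
  lookup (ofList (xs ++ ys)) x ≡ lookup (ofList xs) x ∨ lookup (ofList ys) x
lookup-ofList-++ []       ys x = ≡.cong (_∨ lookup (ofList ys) x) (≡.sym (lookup-⊥ x))
lookup-ofList-++ (y ∷ xs) ys x = begin
  lookup (ofList (y ∷ xs ++ ys)) x                                 ≡⟨ lookup-ofList-∷ y (xs ++ ys) x ⟩
  does (x Fin.≟ y) ∨ lookup (ofList (xs ++ ys)) x                  ≡⟨ ≡.cong (does (x Fin.≟ y) ∨_) (lookup-ofList-++ xs ys x) ⟩
  does (x Fin.≟ y) ∨ (lookup (ofList xs) x ∨ lookup (ofList ys) x) ≡⟨ ≡.sym (Bool.∨-assoc (does (x Fin.≟ y)) _ _) ⟩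
  (does (x Fin.≟ y) ∨ lookup (ofList xs) x) ∨ lookup (ofList ys) x ≡⟨ ≡.cong (_∨ lookup (ofList ys) x) (≡.sym (lookup-ofList-∷ y xs x)) ⟩
  lookup (ofList (y ∷ xs)) x ∨ lookup (ofList ys) x                ∎
  where open ≡.≡-Reasoning

∣∣≡∑ : ∀ {n} (S : Subset n) → + ∣ S ∣ ≡ ∑ (e S) (allFin n)
∣∣≡∑ []            = ≡.refl
∣∣≡∑ (true ∷ S)  = ≡.trans (≡.cong (_+_ (+ 1)) (∣∣≡∑ S)) (≡.sym (∑-allFin-suc (e (true ∷ S))))
∣∣≡∑ (false ∷ S) = ≡.trans (≡.trans (∣∣≡∑ S) (≡.sym (ℤ.+-identityˡ _))) (≡.sym (∑-allFin-suc (e (false ∷ S))))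

∣∣-insert : ∀ {n} {S T : Subset n} (z : Fin n) → lookup S z ≡ false →
  (∀ x → lookup T x ≡ lookup S x ∨ does (x Fin.≟ z)) → ∣ T ∣ ≡ suc ∣ S ∣
∣∣-insert {n} {S} {T} z z∉S T≗S∪z = ℤ.+-injective (begin
  (+ ∣ T ∣)                                                ≡⟨ ∣∣≡∑ T ⟩
  ∑ (e T) (allFin n)                                       ≡⟨ ∑-cong (allFin n) eT≡eS+δ ⟩
  ∑ (λ x → e S x + 𝟙 (x Fin.≟ z)) (allFin n)               ≡⟨ ∑-+ (e S) _ (allFin n) ⟩
  ∑ (e S) (allFin n) + ∑ (λ x → 𝟙 (x Fin.≟ z)) (allFin n)  ≡⟨ ≡.cong₂ _+_ (≡.sym (∣∣≡∑ S)) (allFin-enumerates n z) ⟩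
  (+ ∣ S ∣) + (+ 1)                                        ≡⟨ ℤ.+-comm (+ ∣ S ∣) (+ 1) ⟩
  (+ suc ∣ S ∣)                                            ∎)
  where
  open ≡.≡-Reasoning
  eT≡eS+δ : ∀ x → e T x ≡ e S x + 𝟙 (x Fin.≟ z)
  eT≡eS+δ x with x Fin.≟ z | T≗S∪z x
  ... | yes ≡.refl | Tz rewrite z∉S | Tz = ≡.refl
  ... | no _       | Tx rewrite Tx | Bool.∨-identityʳ (lookup S x) with lookup S x
  ...   | true  = ≡.refl
  ...   | false = ≡.refl

any-allSubsets : ∀ {n} {P : Pred (Subset n) 0ℓ} (S : Subset n) → P S → Any P (allSubsets n)
any-allSubsets {zero}  []          p = here p
any-allSubsets {suc n} (false ∷ S) p = concatMap⁺ _ (any-allSubsets S (here p))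
any-allSubsets {suc n} (true ∷ S)  p = concatMap⁺ _ (any-allSubsets S (there (here p)))

∃-∈ : ∀ {n} (S : Subset n) → 0 < ∣ S ∣ → ∃ λ x → lookup S x ≡ true
∃-∈ (true ∷ S)  _      = Fin.zero , ≡.refl
∃-∈ (false ∷ S) 0<∣S∣ = let x , x∈S = ∃-∈ S 0<∣S∣ in Fin.suc x , x∈S

∃-∉ : ∀ {n} (S : Subset n) → ∣ S ∣ < n → ∃ λ x → lookup S x ≡ false
∃-∉ (false ∷ S) _          = Fin.zero , ≡.refl
∃-∉ (true ∷ S)  (s≤s ∣S∣<n) = let x , x∉S = ∃-∉ S ∣S∣<n in Fin.suc x , x∉S

⊆⁅⁆-≢ : ∀ {n} {A : Subset n} {z x} → A ⊆ ⁅ z ⁆ → x ≢ z → lookup A x ≡ false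
⊆⁅⁆-≢ {A = A} {z} {x} A⊆z x≢z with lookup A x in x∈?A
... | false = ≡.refl
... | true  = contradiction (Subset.x∈⁅y⁆⇒x≡y z (A⊆z (Vec.lookup⇒[]= x A x∈?A))) x≢z

⊆⁅⁆ : ∀ {n} {A : Subset n} z → A ⊆ ⁅ z ⁆ → A ≡ Subset.⊥ ⊎ A ≡ ⁅ z ⁆
⊆⁅⁆ {A = A} z A⊆z with lookup A z in z∈?A
... | false = inj₁ (lookup-ext λ x → ≡.trans (at x) (≡.sym (lookup-⊥ x)))
  where
  at : ∀ x → lookup A x ≡ false
  at x with x Fin.≟ z
  ... | yes ≡.refl = z∈?A
  ... | no x≢z     = ⊆⁅⁆-≢ A⊆z x≢z
... | true = inj₂ (lookup-ext λ x → ≡.trans (at x) (≡.sym (lookup-⁅⁆ z x)))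
  where
  at : ∀ x → lookup A x ≡ does (x Fin.≟ z)
  at x with x Fin.≟ z
  ... | yes ≡.refl = z∈?A
  ... | no x≢z     = ⊆⁅⁆-≢ A⊆z x≢z

⁅⁆-injective : ∀ {n} {x y : Fin n} → ⁅ x ⁆ ≡ ⁅ y ⁆ → x ≡ y
⁅⁆-injective {x = x} {y} eq = Subset.x∈⁅y⁆⇒x≡y y (≡.subst (x Subset.∈_) eq (Subset.x∈⁅x⁆ x))

toggle : ∀ {n} → Fin n → Subset n → Subset n
toggle i S = updateAt S i not

lookup-toggle : ∀ {n} (i : Fin n) S → lookup (toggle i S) i ≡ not (lookup S i)
lookup-toggle i S = Vec.lookup∘updateAt i S

lookup-toggle-≢ : ∀ {n} {i x : Fin n} S → x ≢ i → lookup (toggle i S) x ≡ lookup S x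
lookup-toggle-≢ {i = i} {x} S x≢i = Vec.lookup∘updateAt′ x i x≢i S

toggle-involutive : ∀ {n} (i : Fin n) S → toggle i (toggle i S) ≡ S
toggle-involutive i S = ≡.trans (Vec.updateAt-updateAt-local i S (Bool.not-involutive _)) (Vec.updateAt-id i S)

∣toggle∣-∉ : ∀ {n} (i : Fin n) S → lookup S i ≡ false → ∣ toggle i S ∣ ≡ suc ∣ S ∣
∣toggle∣-∉ i S i∉S = ∣∣-insert {S = S} {toggle i S} i i∉S toggled
  where
  toggled : ∀ x → lookup (toggle i S) x ≡ lookup S x ∨ does (x Fin.≟ i)
  toggled x with x Fin.≟ i
  ... | yes ≡.refl rewrite lookup-toggle x S | i∉S = ≡.refl
  ... | no x≢i     rewrite lookup-toggle-≢ S x≢i = ≡.sym (Bool.∨-identityʳ _)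

∣toggle∣-∈ : ∀ {n} (i : Fin n) S → lookup S i ≡ true → ∣ S ∣ ≡ suc ∣ toggle i S ∣
∣toggle∣-∈ i S i∈S = ≡.trans (≡.cong ∣_∣ (≡.sym (toggle-involutive i S)))
  (∣toggle∣-∉ i (toggle i S) (≡.trans (lookup-toggle i S) (≡.cong not i∈S)))

∑-toggle : ∀ {n} (f : Subset n → ℤ) (i : Fin n) → ∑ f (allSubsets n) ≡ ∑ (f ∘ toggle i) (allSubsets n)
∑-toggle {suc n} f Fin.zero = begin
  ∑ f (allSubsets (suc n))                               ≡⟨ ∑-allSubsets-suc f ⟩
  ∑ (λ S → f (false ∷ S) + f (true ∷ S)) (allSubsets n)  ≡⟨ ∑-cong (allSubsets n) (λ S → ℤ.+-comm (f (false ∷ S)) _) ⟩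
  ∑ (λ S → f (true ∷ S) + f (false ∷ S)) (allSubsets n)  ≡⟨ ∑-allSubsets-suc (f ∘ toggle Fin.zero) ⟨
  ∑ (f ∘ toggle Fin.zero) (allSubsets (suc n))           ∎
  where open ≡.≡-Reasoning
∑-toggle {suc n} f (Fin.suc i) = begin
  ∑ f (allSubsets (suc n))
    ≡⟨ ∑-allSubsets-suc f ⟩
  ∑ (λ S → f (false ∷ S) + f (true ∷ S)) (allSubsets n)
    ≡⟨ ∑-+ _ _ (allSubsets n) ⟩
  ∑ (f ∘ (false ∷_)) (allSubsets n) + ∑ (f ∘ (true ∷_)) (allSubsets n)
    ≡⟨ ≡.cong₂ _+_ (∑-toggle (f ∘ (false ∷_)) i) (∑-toggle (f ∘ (true ∷_)) i) ⟩
  ∑ (λ S → f (false ∷ toggle i S)) (allSubsets n) + ∑ (λ S → f (true ∷ toggle i S)) (allSubsets n)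
    ≡⟨ ∑-+ _ _ (allSubsets n) ⟨
  ∑ (λ S → f (false ∷ toggle i S) + f (true ∷ toggle i S)) (allSubsets n)
    ≡⟨ ∑-allSubsets-suc (f ∘ toggle (Fin.suc i)) ⟨
  ∑ (f ∘ toggle (Fin.suc i)) (allSubsets (suc n))
    ∎
  where open ≡.≡-Reasoning

module Cyclic (m : ℕ) where

  N : ℕ
  N = suc m

  toℕ-⊕ : (i : Fin N) (a : ℕ) → toℕ (i ⊕ a) ≡ (toℕ i ℕ.+ a) % N
  toℕ-⊕ i a = Fin.toℕ-fromℕ< (ℕ.m%n<n (toℕ i ℕ.+ a) N)

  +-cong-% : ∀ x {a b} → a % N ≡ b % N → (x ℕ.+ a) % N ≡ (x ℕ.+ b) % N
  +-cong-% x {a} {b} a≡b = begin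
    (x ℕ.+ a) % N          ≡⟨ ℕ.%-distribˡ-+ x a N ⟩
    (x % N ℕ.+ a % N) % N  ≡⟨ ≡.cong (λ t → (x % N ℕ.+ t) % N) a≡b ⟩
    (x % N ℕ.+ b % N) % N  ≡⟨ ≡.sym (ℕ.%-distribˡ-+ x b N) ⟩
    (x ℕ.+ b) % N          ∎
    where open ≡.≡-Reasoning

  ⊕-cong-% : (i : Fin N) {a b : ℕ} → a % N ≡ b % N → i ⊕ a ≡ i ⊕ b
  ⊕-cong-% i {a} {b} a≡b = Fin.toℕ-injective (≡.trans (toℕ-⊕ i a) (≡.trans (+-cong-% (toℕ i) a≡b) (≡.sym (toℕ-⊕ i b))))

  ⊕-injective-% : (i : Fin N) {a b : ℕ} → i ⊕ a ≡ i ⊕ b → a % N ≡ b % N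
  ⊕-injective-% i {a} {b} i⊕a≡i⊕b = begin
    a % N                                       ≡⟨ ≡.sym (ℕ.[m+n]%n≡m%n a N) ⟩
    (a ℕ.+ N) % N                               ≡⟨ ≡.cong (_% N) (≡.sym (complement a)) ⟩
    ((x ℕ.+ a) ℕ.+ (N ℕ.∸ x)) % N               ≡⟨ ℕ.%-distribˡ-+ (x ℕ.+ a) (N ℕ.∸ x) N ⟩
    ((x ℕ.+ a) % N ℕ.+ (N ℕ.∸ x) % N) % N       ≡⟨ ≡.cong (λ t → (t ℕ.+ (N ℕ.∸ x) % N) % N) x+a≡x+b ⟩
    ((x ℕ.+ b) % N ℕ.+ (N ℕ.∸ x) % N) % N       ≡⟨ ≡.sym (ℕ.%-distribˡ-+ (x ℕ.+ b) (N ℕ.∸ x) N) ⟩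
    ((x ℕ.+ b) ℕ.+ (N ℕ.∸ x)) % N               ≡⟨ ≡.cong (_% N) (complement b) ⟩
    (b ℕ.+ N) % N                               ≡⟨ ℕ.[m+n]%n≡m%n b N ⟩
    b % N                                       ∎
    where
    open ≡.≡-Reasoning
    x = toℕ i
    x+a≡x+b : (x ℕ.+ a) % N ≡ (x ℕ.+ b) % N
    x+a≡x+b = ≡.trans (≡.sym (toℕ-⊕ i a)) (≡.trans (≡.cong toℕ i⊕a≡i⊕b) (toℕ-⊕ i b))
    complement : ∀ c → (x ℕ.+ c) ℕ.+ (N ℕ.∸ x) ≡ c ℕ.+ N
    complement c = ≡.trans (≡.cong (ℕ._+ (N ℕ.∸ x)) (ℕ.+-comm x c))
      (≡.trans (ℕ.+-assoc c x (N ℕ.∸ x)) (≡.cong (c ℕ.+_) (ℕ.m+[n∸m]≡n (ℕ.<⇒≤ (Fin.toℕ<n i)))))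

  ⊕-injective : (i : Fin N) {a b : ℕ} → a < N → b < N → i ⊕ a ≡ i ⊕ b → a ≡ b
  ⊕-injective i a<N b<N i⊕a≡i⊕b =
    ≡.trans (≡.sym (ℕ.m<n⇒m%n≡m a<N)) (≡.trans (⊕-injective-% i i⊕a≡i⊕b) (ℕ.m<n⇒m%n≡m b<N))

  ⊕-⊕ : (i : Fin N) (a b : ℕ) → (i ⊕ a) ⊕ b ≡ i ⊕ (a ℕ.+ b)
  ⊕-⊕ i a b = Fin.toℕ-injective (begin
    toℕ ((i ⊕ a) ⊕ b)                  ≡⟨ toℕ-⊕ (i ⊕ a) b ⟩
    (toℕ (i ⊕ a) ℕ.+ b) % N            ≡⟨ ≡.cong (λ t → (t ℕ.+ b) % N) (toℕ-⊕ i a) ⟩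
    ((toℕ i ℕ.+ a) % N ℕ.+ b) % N      ≡⟨ +-cong-% ((toℕ i ℕ.+ a) % N) (≡.sym (ℕ.m%n%n≡m%n b N)) ⟩
    ((toℕ i ℕ.+ a) % N ℕ.+ b % N) % N  ≡⟨ ≡.sym (ℕ.%-distribˡ-+ (toℕ i ℕ.+ a) b N) ⟩
    (toℕ i ℕ.+ a ℕ.+ b) % N            ≡⟨ ≡.cong (_% N) (ℕ.+-assoc (toℕ i) a b) ⟩
    (toℕ i ℕ.+ (a ℕ.+ b)) % N          ≡⟨ ≡.sym (toℕ-⊕ i (a ℕ.+ b)) ⟩
    toℕ (i ⊕ (a ℕ.+ b))                ∎)
    where open ≡.≡-Reasoning

  ⊕-⊕1 : (i : Fin N) (a : ℕ) → (i ⊕ a) ⊕ 1 ≡ i ⊕ suc a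
  ⊕-⊕1 i a = ≡.trans (⊕-⊕ i a 1) (≡.cong (i ⊕_) (ℕ.+-comm a 1))

  ⊕-identityʳ : (i : Fin N) → i ⊕ 0 ≡ i
  ⊕-identityʳ i = Fin.toℕ-injective
    (≡.trans (toℕ-⊕ i 0) (≡.trans (≡.cong (_% N) (ℕ.+-identityʳ (toℕ i))) (ℕ.m<n⇒m%n≡m (Fin.toℕ<n i))))

  ⊕-+N : (i : Fin N) (a : ℕ) → i ⊕ (a ℕ.+ N) ≡ i ⊕ a
  ⊕-+N i a = ⊕-cong-% i (ℕ.[m+n]%n≡m%n a N)

  offset : (c x : Fin N) → ∃ λ d → d < N × x ≡ c ⊕ d
  offset c x = d , ℕ.m%n<n D N , Fin.toℕ-injective (begin
    toℕ x                  ≡⟨ ≡.sym (ℕ.m<n⇒m%n≡m (Fin.toℕ<n x)) ⟩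
    toℕ x % N              ≡⟨ ≡.sym (ℕ.[m+n]%n≡m%n (toℕ x) N) ⟩
    (toℕ x ℕ.+ N) % N      ≡⟨ ≡.cong (_% N) (≡.sym (ℕ.m+[n∸m]≡n c≤x+N)) ⟩
    (toℕ c ℕ.+ D) % N      ≡⟨ +-cong-% (toℕ c) (≡.sym (ℕ.m%n%n≡m%n D N)) ⟩
    (toℕ c ℕ.+ d) % N      ≡⟨ ≡.sym (toℕ-⊕ c d) ⟩
    toℕ (c ⊕ d)            ∎)
    where
    open ≡.≡-Reasoning
    D = toℕ x ℕ.+ N ℕ.∸ toℕ c
    d = D % N
    c≤x+N : toℕ c ≤ toℕ x ℕ.+ N
    c≤x+N = ℕ.≤-trans (ℕ.<⇒≤ (Fin.toℕ<n c)) (ℕ.m≤n+m N (toℕ x))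

  prev : Fin N → Fin N
  prev i = i ⊕ m

  ⊕suc∘prev : (i : Fin N) (a : ℕ) → prev i ⊕ suc a ≡ i ⊕ a
  ⊕suc∘prev i a = ≡.trans (⊕-⊕ i m (suc a)) (≡.trans (≡.cong (i ⊕_) (≡.trans (ℕ.+-suc m a) (ℕ.+-comm N a))) (⊕-+N i a))

  ⊕1∘prev : (i : Fin N) → prev i ⊕ 1 ≡ i
  ⊕1∘prev i = ≡.trans (⊕suc∘prev i 0) (⊕-identityʳ i)

  prev∘⊕suc : (i : Fin N) (a : ℕ) → prev (i ⊕ suc a) ≡ i ⊕ a
  prev∘⊕suc i a = ≡.trans (⊕-⊕ i (suc a) m) (≡.trans (≡.cong (i ⊕_) (≡.sym (ℕ.+-suc a m))) (⊕-+N i a))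

  prev∘⊕1 : (i : Fin N) → prev (i ⊕ 1) ≡ i
  prev∘⊕1 i = ≡.trans (prev∘⊕suc i 0) (⊕-identityʳ i)

  prev≡⇒≡⊕1 : ∀ {x y} → prev x ≡ y → x ≡ y ⊕ 1
  prev≡⇒≡⊕1 {x} prev-x≡y = ≡.trans (≡.sym (⊕1∘prev x)) (≡.cong (_⊕ 1) prev-x≡y)

  prev-injective : ∀ {x y} → prev x ≡ prev y → x ≡ y
  prev-injective {x} {y} eq = ≡.trans (prev≡⇒≡⊕1 eq) (⊕1∘prev y)

  ≡⊕1⇔≡prev : ∀ {i x} → i ≡ x ⊕ 1 ⇔ x ≡ prev i
  ≡⊕1⇔≡prev {i} {x} = mk⇔ (λ i≡x⊕1 → ≡.trans (≡.sym (prev∘⊕1 x)) (≡.cong prev (≡.sym i≡x⊕1))) (prev≡⇒≡⊕1 ∘ ≡.sym)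

  ⊕1-≢ : 1 < N → ∀ x → x ⊕ 1 ≢ x
  ⊕1-≢ 1<N x eq = contradiction (⊕-injective x 1<N (s≤s z≤n) (≡.trans eq (≡.sym (⊕-identityʳ x)))) λ ()

  prev-≢ : 1 < N → ∀ x → prev x ≢ x
  prev-≢ 1<N x eq = ⊕1-≢ 1<N x (≡.sym (prev≡⇒≡⊕1 eq))

  prev^ : ℕ → Fin N → Fin N
  prev^ zero    x = x
  prev^ (suc t) x = prev^ t (prev x)

  prev^-⊕ : ∀ x t → prev^ t (x ⊕ t) ≡ x
  prev^-⊕ x zero    = ⊕-identityʳ x
  prev^-⊕ x (suc t) = ≡.trans (≡.cong (prev^ t) (prev∘⊕suc x t)) (prev^-⊕ x t)

  ⊕-cancelʳ : ∀ {x y} t → x ⊕ t ≡ y ⊕ t → x ≡ y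
  ⊕-cancelʳ {x} {y} t eq = ≡.trans (≡.sym (prev^-⊕ x t)) (≡.trans (≡.cong (prev^ t) eq) (prev^-⊕ y t))

  left-end : (S : Subset N) → 0 < ∣ S ∣ → ∣ S ∣ < N → ∃ λ b → lookup S b ≡ true × lookup S (prev b) ≡ false
  left-end S 0<∣S∣ ∣S∣<N with ∃-∈ S 0<∣S∣ | ∃-∉ S ∣S∣<N
  ... | x , x∈S | c , c∉S with offset c x
  ...   | d , _ , ≡.refl = search d x∈S
    where
    search : ∀ t → lookup S (c ⊕ t) ≡ true → ∃ λ b → lookup S b ≡ true × lookup S (prev b) ≡ false
    search zero    c∈S = contradiction (≡.trans (≡.sym c∉S) (≡.trans (≡.cong (lookup S) (≡.sym (⊕-identityʳ c))) c∈S)) λ ()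
    search (suc t) c⊕t+1∈S with lookup S (c ⊕ t) in c⊕t∈?S
    ... | true  = search t c⊕t∈?S
    ... | false = c ⊕ suc t , c⊕t+1∈S , ≡.trans (≡.cong (lookup S) (prev∘⊕suc c t)) c⊕t∈?S

-- Membership in a cubical array

-- The equation e_M = e_J + e_{A+1} − e_A with A = J ∖ M, at a position i, in terms of the
-- memberships of i − 1 and i in J and in M.
CubeStep : (jPrev mPrev j m : Bool) → Set
CubeStep jPrev mPrev j m = bit m ≡ bit j + (bit (jPrev ∧ not mPrev) - bit (j ∧ not m))

CubeStep-enter : ∀ a c → CubeStep a false c true → a ≡ not c
CubeStep-enter true  true  ()
CubeStep-enter true  false _  = ≡.refl
CubeStep-enter false true  _  = ≡.refl
CubeStep-enter false false ()

CubeStep-enter⁻ : ∀ a c → a ≡ not c → CubeStep a false c true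
CubeStep-enter⁻ true  false _ = ≡.refl
CubeStep-enter⁻ false true  _ = ≡.refl

CubeStep-∉-irrelevant : ∀ a b j j′ → CubeStep a b j false → CubeStep a b j′ false
CubeStep-∉-irrelevant true  false true  _     ()
CubeStep-∉-irrelevant true  false false _     ()
CubeStep-∉-irrelevant true  true  _     true  _ = ≡.refl
CubeStep-∉-irrelevant true  true  _     false _ = ≡.refl
CubeStep-∉-irrelevant false _     _     true  _ = ≡.refl
CubeStep-∉-irrelevant false _     _     false _ = ≡.refl

CubeStep-prev∈-irrelevant : ∀ a a′ j m → CubeStep a true j m → CubeStep a′ true j m
CubeStep-prev∈-irrelevant true  true  j m step = step
CubeStep-prev∈-irrelevant true  false j m step = step
CubeStep-prev∈-irrelevant false true  j m step = step
CubeStep-prev∈-irrelevant false false j m step = step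

CubeStep-leave : ∀ j m → CubeStep true false j m → j ≡ false
CubeStep-leave false m _ = ≡.refl
CubeStep-leave true true  ()
CubeStep-leave true false ()

J─M-forced : ∀ a aPrev j m → (a ≡ true → j ≡ true) → (aPrev ≡ true → not j ≡ true) →
  bit m ≡ bit j + (bit aPrev - bit a) → a ≡ j ∧ not m
J─M-forced true  aPrev false m     a→j _        _  = contradiction (a→j ≡.refl) λ ()
J─M-forced true  true  true  m     _   aPrev→¬j _  = contradiction (aPrev→¬j ≡.refl) λ ()
J─M-forced true  false true  true  _   _        ()
J─M-forced true  false true  false _   _        _  = ≡.refl
J─M-forced false aPrev false m     _   _        _  = ≡.refl
J─M-forced false true  true  m     _   aPrev→¬j _  = contradiction (aPrev→¬j ≡.refl) λ ()
J─M-forced false false true  true  _   _        _  = ≡.refl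
J─M-forced false false true  false _   _        ()

module CubeMembership (m : ℕ) where
  open Cyclic m

  Local : Subset N → Subset N → Set
  Local J M = ∀ i → CubeStep (lookup J (prev i)) (lookup M (prev i)) (lookup J i) (lookup M i)

  private
    shift-term : ∀ a c₁ c₂ → guard a (bit c₁ - bit c₂) ≡ guard c₁ (bit a) - guard c₂ (bit a)
    shift-term true  c₁    c₂    = ≡.refl
    shift-term false false false = ≡.refl
    shift-term false false true  = ≡.refl
    shift-term false true  false = ≡.refl
    shift-term false true  true  = ≡.refl

  cubeVec-local : (J A : Subset N) (i : Fin N) → cubeVec J A i ≡ e J i + (e A (prev i) - e A i)
  cubeVec-local J A i = ≡.cong (_+_ (e J i)) (begin
    ∑ (λ x → guard (lookup A x) (δ (x ⊕ 1) i - δ x i)) (allFin N)  ≡⟨ ∑-cong (allFin N) split ⟩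
    ∑ (λ x → at (prev i) x - at i x) (allFin N)                     ≡⟨ ∑-+ (at (prev i)) _ (allFin N) ⟩
    ∑ (at (prev i)) (allFin N) + ∑ (λ x → - at i x) (allFin N)      ≡⟨ ≡.cong (_+_ (∑ (at (prev i)) (allFin N))) (∑-neg (at i) (allFin N)) ⟨
    ∑ (at (prev i)) (allFin N) - ∑ (at i) (allFin N)                ≡⟨ ≡.cong₂ _-_ (pick (prev i)) (pick i) ⟩
    e A (prev i) - e A i                                            ∎)
    where
    open ≡.≡-Reasoning
    at : Fin N → Fin N → ℤ
    at y x = guard (does (x Fin.≟ y)) (e A x)
    pick : ∀ y → ∑ (at y) (allFin N) ≡ e A y
    pick y = ∑-δ Fin._≟_ (allFin N) (allFin-enumerates N) y (e A)
    split : ∀ x → guard (lookup A x) (δ (x ⊕ 1) i - δ x i) ≡ at (prev i) x - at i x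
    split x = ≡.trans
      (≡.cong₂ (λ c₁ c₂ → guard (lookup A x) (bit c₁ - bit c₂))
        (≡.trans (lookup-⁅⁆ (x ⊕ 1) i) (does-⇔ ≡⊕1⇔≡prev (i Fin.≟ x ⊕ 1) (x Fin.≟ prev i)))
        (≡.trans (lookup-⁅⁆ x i) (does-⇔ (mk⇔ ≡.sym ≡.sym) (i Fin.≟ x) (x Fin.≟ i))))
      (shift-term (lookup A x) (does (x Fin.≟ prev i)) (does (x Fin.≟ i)))

  lookup-IJ : (J : Subset N) (x : Fin N) → lookup (IJ J) x ≡ lookup J x ∧ not (lookup J (x ⊕ 1))
  lookup-IJ J x = Vec.lookup∘tabulate (λ j → (j ∈ᵇ J) ∧ not ((j ⊕ 1) ∈ᵇ J)) x

  InCube⇒Local : (J M : Subset N) → InCube J M → Local J M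
  InCube⇒Local J M J→M i =
    ≡.subst₂ (λ a aPrev → bit (lookup M i) ≡ bit (lookup J i) + (bit aPrev - bit a)) (A≡J─M i) (A≡J─M (prev i))
      (≡.trans (eM≡ i) (cubeVec-local J A i))
    where
    A = proj₁ (Any.satisfied J→M)
    A⊆IJ : A ⊆ IJ J
    A⊆IJ = proj₁ (proj₂ (Any.satisfied J→M))
    eM≡ : ∀ x → e M x ≡ cubeVec J A x
    eM≡ = proj₂ (proj₂ (Any.satisfied J→M))
    A⊆IJ′ : ∀ x → lookup A x ≡ true → lookup J x ∧ not (lookup J (x ⊕ 1)) ≡ true
    A⊆IJ′ x x∈A = ≡.trans (≡.sym (lookup-IJ J x)) (Vec.[]=⇒lookup (A⊆IJ (Vec.lookup⇒[]= x A x∈A)))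
    A≡J─M : ∀ x → lookup A x ≡ lookup J x ∧ not (lookup M x)
    A≡J─M x = J─M-forced (lookup A x) (lookup A (prev x)) (lookup J x) (lookup M x)
      (λ x∈A → Bool.∧-conicalˡ _ _ (A⊆IJ′ x x∈A))
      (λ prev-x∈A → ≡.subst (λ y → not (lookup J y) ≡ true) (⊕1∘prev x) (Bool.∧-conicalʳ _ _ (A⊆IJ′ (prev x) prev-x∈A)))
      (≡.trans (eM≡ x) (cubeVec-local J A x))

  Local⇒InCube : (J M : Subset N) → Local J M → InCube J M
  Local⇒InCube J M local = any-allSubsets (J ─ M) (J─M⊆IJ , eM≡)
    where
    J─M⊆IJ : J ─ M ⊆ IJ J
    J─M⊆IJ {x} x∈J─M = Vec.lookup⇒[]= x (IJ J) (≡.trans (lookup-IJ J x) (≡.cong₂ _∧_ x∈J (≡.cong not x⊕1∉J)))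
      where
      J∧¬M : lookup J x ∧ not (lookup M x) ≡ true
      J∧¬M = ≡.trans (≡.sym (lookup-─ J M x)) (Vec.[]=⇒lookup x∈J─M)
      x∈J : lookup J x ≡ true
      x∈J = Bool.∧-conicalˡ _ _ J∧¬M
      x∉M : not (lookup M x) ≡ true
      x∉M = Bool.∧-conicalʳ _ _ J∧¬M
      x⊕1∉J : lookup J (x ⊕ 1) ≡ false
      x⊕1∉J with local (x ⊕ 1)
      ... | step rewrite prev∘⊕1 x | x∈J | x∉M = CubeStep-leave _ _ step
    eM≡ : ∀ i → e M i ≡ cubeVec J (J ─ M) i
    eM≡ i = ≡.trans
      (≡.subst₂ (λ a aPrev → bit (lookup M i) ≡ bit (lookup J i) + (bit aPrev - bit a))
        (≡.sym (lookup-─ J M i)) (≡.sym (lookup-─ J M (prev i))) (local i))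
      (≡.sym (cubeVec-local J (J ─ M) i))

-- The sign-reversing involution

cubeCoeff : ∀ {n} → ℕ → Subset n → Subset n → ℤ
cubeCoeff k J M = guard (does (∣ J ∣ ℕ.≟ k)) (guard (does (inCube? J M)) (sgn k J M))

cubeCoeff-neg : ∀ {n} k (J J′ M : Subset n) → (InCube J′ M ⇔ InCube J M) →
  (InCube J M → ∣ J′ ∣ ≡ ∣ J ∣ × sgn k J′ M ≡ - sgn k J M) → cubeCoeff k J′ M ≡ - cubeCoeff k J M
cubeCoeff-neg k J J′ M J′⇔J flips with inCube? J M | inCube? J′ M
... | yes J→M | no ¬J′→M = contradiction (Equivalence.from J′⇔J J→M) ¬J′→M
... | no ¬J→M | yes J′→M = contradiction (Equivalence.to J′⇔J J′→M) ¬J→M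
... | no _    | no _     = ≡.trans (guard-0 (does (∣ J′ ∣ ℕ.≟ k))) (≡.cong -_ (≡.sym (guard-0 (does (∣ J ∣ ℕ.≟ k)))))
... | yes J→M | yes _ with flips J→M
...   | ∣J′∣≡∣J∣ , sgn-flips rewrite ∣J′∣≡∣J∣ with does (∣ J ∣ ℕ.≟ k)
...     | true  = sgn-flips
...     | false = ≡.refl

sgn-suc : ∀ {n} k (J J′ M : Subset n) → ∣ J′ ∩ M ∣ ≡ suc ∣ J ∩ M ∣ → sgn k J′ M ≡ - sgn k J M
sgn-suc k J J′ M eq = ≡.trans (≡.cong (λ a → -1ℤ ℤ.^ (a ℕ.+ k ℕ.+ 1)) eq) (ℤ.-1*i≡-i _)

module Involution (m : ℕ) where
  open Cyclic (suc (suc m))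
  open CubeMembership (suc (suc m))

  1<N : 1 < N
  1<N = s≤s (s≤s z≤n)

  ⊕2-≢ : ∀ x → (x ⊕ 1) ⊕ 1 ≢ x
  ⊕2-≢ x eq = contradiction
    (⊕-injective x (s≤s (s≤s (s≤s z≤n))) (s≤s z≤n) (≡.trans (≡.sym (⊕-⊕1 x 1)) (≡.trans eq (≡.sym (⊕-identityʳ x))))) λ ()

  prev²-≢ : ∀ x → prev (prev x) ≢ x
  prev²-≢ x eq = ⊕2-≢ x (≡.sym (prev≡⇒≡⊕1 (prev≡⇒≡⊕1 eq)))

  module Flip (M : Subset N) (b : Fin N) (b∈M : lookup M b ≡ true) (q∉M : lookup M (prev b) ≡ false) where

    q r s : Fin N
    q = prev b
    r = prev q
    s = b ⊕ 1

    s≢q : s ≢ q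
    s≢q s≡q = prev²-≢ b (≡.sym (≡.trans (≡.sym (prev∘⊕1 b)) (≡.cong prev s≡q)))

    ι : Subset N → Subset N
    ι J = toggle q (toggle b J)

    ι-at-q : ∀ J → lookup (ι J) q ≡ not (lookup J q)
    ι-at-q J = ≡.trans (lookup-toggle q (toggle b J)) (≡.cong not (lookup-toggle-≢ J (prev-≢ 1<N b)))

    ι-at-b : ∀ J → lookup (ι J) b ≡ not (lookup J b)
    ι-at-b J = ≡.trans (lookup-toggle-≢ (toggle b J) (prev-≢ 1<N b ∘ ≡.sym)) (lookup-toggle b J)

    ι-elsewhere : ∀ J {x} → x ≢ q → x ≢ b → lookup (ι J) x ≡ lookup J x
    ι-elsewhere J x≢q x≢b = ≡.trans (lookup-toggle-≢ (toggle b J) x≢q) (lookup-toggle-≢ J x≢b)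

    ι-involutive : ∀ J → ι (ι J) ≡ J
    ι-involutive J = lookup-ext twice
      where
      twice : ∀ x → lookup (ι (ι J)) x ≡ lookup J x
      twice x with x Fin.≟ q | x Fin.≟ b
      ... | yes ≡.refl | _          = ≡.trans (ι-at-q (ι J)) (≡.trans (≡.cong not (ι-at-q J)) (Bool.not-involutive _))
      ... | no _       | yes ≡.refl = ≡.trans (ι-at-b (ι J)) (≡.trans (≡.cong not (ι-at-b J)) (Bool.not-involutive _))
      ... | no x≢q     | no x≢b     = ≡.trans (ι-elsewhere (ι J) x≢q x≢b) (ι-elsewhere J x≢q x≢b)

    Local⇒q≡¬b : ∀ J → Local J M → lookup J q ≡ not (lookup J b)
    Local⇒q≡¬b J local = CubeStep-enter _ _ (≡.subst₂ (λ mq mb → CubeStep (lookup J q) mq (lookup J b) mb) q∉M b∈M (local b))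

    -- Only the steps at q, b and s = b + 1 read a toggled position.
    ι-Local : ∀ J → Local J M → Local (ι J) M
    ι-Local J local i with i Fin.≟ b | i Fin.≟ q | i Fin.≟ s
    ... | yes ≡.refl | _ | _ rewrite ι-at-q J | ι-at-b J | q∉M | b∈M =
      CubeStep-enter⁻ (not (lookup J q)) (not (lookup J b)) (≡.cong not (Local⇒q≡¬b J local))
    ... | no _ | yes ≡.refl | _ rewrite ι-elsewhere J (prev-≢ 1<N q) (prev²-≢ b) | ι-at-q J | q∉M =
      CubeStep-∉-irrelevant (lookup J r) (lookup M r) (lookup J q) (not (lookup J q))
        (≡.subst (CubeStep (lookup J r) (lookup M r) (lookup J q)) q∉M (local q))
    ... | no _ | no _ | yes ≡.refl rewrite prev∘⊕1 b | ι-at-b J | ι-elsewhere J s≢q (⊕1-≢ 1<N b) | b∈M =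
      CubeStep-prev∈-irrelevant (lookup J b) (not (lookup J b)) (lookup J s) (lookup M s)
        (≡.subst (λ mb → CubeStep (lookup J b) mb (lookup J s) (lookup M s)) b∈M
        (≡.subst (λ y → CubeStep (lookup J y) (lookup M y) (lookup J s) (lookup M s)) (prev∘⊕1 b) (local s)))
    ... | no i≢b | no i≢q | no i≢s
      rewrite ι-elsewhere J i≢q i≢b
            | ι-elsewhere J {prev i} (i≢b ∘ prev-injective) (i≢s ∘ prev≡⇒≡⊕1) =
      local i

    ι-InCube⇔ : ∀ J → InCube (ι J) M ⇔ InCube J M
    ι-InCube⇔ J = mk⇔
      (λ ιJ→M → ≡.subst (λ K → InCube K M) (ι-involutive J) (Local⇒InCube (ι (ι J)) M (ι-Local (ι J) (InCube⇒Local (ι J) M ιJ→M))))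
      (λ J→M → Local⇒InCube (ι J) M (ι-Local J (InCube⇒Local J M J→M)))

    ι∩M-insert : ∀ J → lookup J b ≡ false → ∀ x → lookup (ι J ∩ M) x ≡ lookup (J ∩ M) x ∨ does (x Fin.≟ b)
    ι∩M-insert J b∉J x rewrite lookup-∩ (ι J) M x | lookup-∩ J M x with x Fin.≟ b | x Fin.≟ q
    ... | yes ≡.refl | _ rewrite ι-at-b J | b∉J | b∈M = ≡.refl
    ... | no _ | yes ≡.refl rewrite q∉M = ≡.trans (Bool.∧-zeroʳ _) (≡.sym (≡.trans (Bool.∨-identityʳ _) (Bool.∧-zeroʳ _)))
    ... | no x≢b | no x≢q rewrite ι-elsewhere J x≢q x≢b = ≡.sym (Bool.∨-identityʳ _)

    cubeCoeff-ι-∉ : ∀ k J → lookup J b ≡ false → cubeCoeff k (ι J) M ≡ - cubeCoeff k J M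
    cubeCoeff-ι-∉ k J b∉J = cubeCoeff-neg k J (ι J) M (ι-InCube⇔ J) flips
      where
      flips : InCube J M → ∣ ι J ∣ ≡ ∣ J ∣ × sgn k (ι J) M ≡ - sgn k J M
      flips J→M = ℕ.suc-injective (≡.trans (≡.sym (∣toggle∣-∈ q (toggle b J) q∈)) (∣toggle∣-∉ b J b∉J))
                , sgn-suc k J (ι J) M (∣∣-insert {S = J ∩ M} {ι J ∩ M} b b∉J∩M (ι∩M-insert J b∉J))
        where
        b∉J∩M : lookup (J ∩ M) b ≡ false
        b∉J∩M = ≡.trans (lookup-∩ J M b) (≡.cong (_∧ lookup M b) b∉J)
        q∈ : lookup (toggle b J) q ≡ true
        q∈ = ≡.trans (lookup-toggle-≢ J (prev-≢ 1<N b)) (≡.trans (Local⇒q≡¬b J (InCube⇒Local J M J→M)) (≡.cong not b∉J))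

    cubeCoeff-ι : ∀ k J → cubeCoeff k (ι J) M ≡ - cubeCoeff k J M
    cubeCoeff-ι k J with lookup J b in b∈?J
    ... | false = cubeCoeff-ι-∉ k J b∈?J
    ... | true  = begin
      cubeCoeff k (ι J) M              ≡⟨ ≡.sym (ℤ.neg-involutive _) ⟩
      - - cubeCoeff k (ι J) M          ≡⟨ ≡.cong -_ (≡.sym (cubeCoeff-ι-∉ k (ι J) (≡.trans (ι-at-b J) (≡.cong not b∈?J)))) ⟩
      - cubeCoeff k (ι (ι J)) M        ≡⟨ ≡.cong (λ K → - cubeCoeff k K M) (ι-involutive J) ⟩
      - cubeCoeff k J M                ∎
      where open ≡.≡-Reasoning

    ∑-cubeCoeff≡0 : ∀ k → ∑ (λ J → cubeCoeff k J M) (allSubsets N) ≡ + 0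
    ∑-cubeCoeff≡0 k = i≡-i⇒i≡0 _ (begin
      ∑ f (allSubsets N)                 ≡⟨ ∑-toggle f q ⟩
      ∑ (f ∘ toggle q) (allSubsets N)    ≡⟨ ∑-toggle (f ∘ toggle q) b ⟩
      ∑ (f ∘ ι) (allSubsets N)           ≡⟨ ∑-cong (allSubsets N) (cubeCoeff-ι k) ⟩
      ∑ (λ J → - f J) (allSubsets N)     ≡⟨ ≡.sym (∑-neg f (allSubsets N)) ⟩
      - ∑ f (allSubsets N)               ∎)
      where
      open ≡.≡-Reasoning
      f = λ J → cubeCoeff k J M

  ∑-cubeCoeff≡0 : ∀ k (M : Subset N) → 0 < ∣ M ∣ → ∣ M ∣ < N → ∑ (λ J → cubeCoeff k J M) (allSubsets N) ≡ + 0
  ∑-cubeCoeff≡0 k M 0<∣M∣ ∣M∣<N with left-end M 0<∣M∣ ∣M∣<N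
  ... | b , b∈M , q∉M = Flip.∑-cubeCoeff≡0 M b b∈M q∉M k

-- Cyclic intervals

<-suc-does : ∀ d k → does (d ℕ.<? k) ∨ does (d ℕ.≟ k) ≡ does (d ℕ.<? suc k)
<-suc-does d k with ℕ.<-cmp d k
... | tri< d<k _ _ rewrite dec-true (d ℕ.<? k) d<k = ≡.sym (dec-true (d ℕ.<? suc k) (ℕ.m<n⇒m<1+n d<k))
... | tri≈ _ ≡.refl _ rewrite dec-false (d ℕ.<? d) (ℕ.n≮n d) | dec-true (d ℕ.≟ d) ≡.refl =
  ≡.sym (dec-true (d ℕ.<? suc d) (ℕ.n<1+n d))
... | tri> d≮k d≢k k<d rewrite dec-false (d ℕ.<? k) d≮k | dec-false (d ℕ.≟ k) d≢k =
  ≡.sym (dec-false (d ℕ.<? suc k) (λ d<1+k → ℕ.<-irrefl ≡.refl (ℕ.<-≤-trans k<d (ℕ.≤-pred d<1+k))))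

module Intervals (m : ℕ) where
  open Cyclic m

  lookup-interval-suc : ∀ k (a x : Fin N) → lookup (interval (suc k) a) x ≡ lookup (interval k a) x ∨ does (x Fin.≟ a ⊕ k)
  lookup-interval-suc k a x = begin
    lookup (interval (suc k) a) x
      ≡⟨ ≡.cong (λ ts → lookup (ofList (map (a ⊕_) ts)) x) (List.upTo-∷ʳ k) ⟨
    lookup (ofList (map (a ⊕_) (upTo k ++ k ∷ []))) x
      ≡⟨ ≡.cong (λ ys → lookup (ofList ys) x) (List.map-++ (a ⊕_) (upTo k) (k ∷ [])) ⟩
    lookup (ofList (map (a ⊕_) (upTo k) ++ (a ⊕ k) ∷ [])) x
      ≡⟨ lookup-ofList-++ (map (a ⊕_) (upTo k)) _ x ⟩
    lookup (interval k a) x ∨ lookup (ofList ((a ⊕ k) ∷ [])) x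
      ≡⟨ ≡.cong (lookup (interval k a) x ∨_) (lookup-ofList-[ a ⊕ k ] x) ⟩
    lookup (interval k a) x ∨ does (x Fin.≟ a ⊕ k)
      ∎
    where open ≡.≡-Reasoning

  lookup-interval : ∀ k (a : Fin N) {d} → k ≤ N → d < N → lookup (interval k a) (a ⊕ d) ≡ does (d ℕ.<? k)
  lookup-interval zero    a {d} _   _   = ≡.trans (lookup-⊥ (a ⊕ d)) (≡.sym (dec-false (d ℕ.<? 0) λ ()))
  lookup-interval (suc k) a {d} k<N d<N = begin
    lookup (interval (suc k) a) (a ⊕ d)                           ≡⟨ lookup-interval-suc k a (a ⊕ d) ⟩
    lookup (interval k a) (a ⊕ d) ∨ does (a ⊕ d Fin.≟ a ⊕ k)      ≡⟨ ≡.cong₂ _∨_ (lookup-interval k a (ℕ.<⇒≤ k<N) d<N) a⊕d≡a⊕k ⟩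
    does (d ℕ.<? k) ∨ does (d ℕ.≟ k)                              ≡⟨ <-suc-does d k ⟩
    does (d ℕ.<? suc k)                                           ∎
    where
    open ≡.≡-Reasoning
    a⊕d≡a⊕k : does (a ⊕ d Fin.≟ a ⊕ k) ≡ does (d ℕ.≟ k)
    a⊕d≡a⊕k = does-⇔ (mk⇔ (⊕-injective a d<N k<N) (≡.cong (a ⊕_))) (a ⊕ d Fin.≟ a ⊕ k) (d ℕ.≟ k)

  ∣interval∣ : ∀ k (a : Fin N) → k ≤ N → ∣ interval k a ∣ ≡ k
  ∣interval∣ zero    a _   = Subset.∣⊥∣≡0 N
  ∣interval∣ (suc k) a k<N = ≡.trans
    (∣∣-insert {S = interval k a} {interval (suc k) a} (a ⊕ k)
      (≡.trans (lookup-interval k a (ℕ.<⇒≤ k<N) k<N) (dec-false (k ℕ.<? k) (ℕ.n≮n k)))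
      (lookup-interval-suc k a))
    (≡.cong suc (∣interval∣ k a (ℕ.<⇒≤ k<N)))

module CyclicInterval (m k₁ : ℕ) (k<N : suc k₁ < suc m) (j : Fin (suc m)) where
  open Cyclic m
  open Intervals m
  open CubeMembership m

  k : ℕ
  k = suc k₁

  a z z⁺ : Fin N
  a  = j ⊕ 1
  z  = a ⊕ k₁
  z⁺ = a ⊕ k

  J G I₁ : Subset N
  J  = cyc k j
  G  = gap k j
  I₁ = interval k₁ a

  k₁<N : k₁ < N
  k₁<N = ℕ.<-trans (ℕ.n<1+n k₁) k<N

  cyc≡interval : J ≡ interval k a
  cyc≡interval = ≡.cong ofList (List.map-cong (λ t → ≡.sym (⊕-⊕ j 1 t)) (upTo k))

  lookup-J : ∀ x → lookup J x ≡ lookup I₁ x ∨ does (x Fin.≟ z)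
  lookup-J x = ≡.trans (≡.cong (λ S → lookup S x) cyc≡interval) (lookup-interval-suc k₁ a x)

  lookup-G : ∀ x → lookup G x ≡ lookup I₁ x ∨ does (x Fin.≟ z⁺)
  lookup-G x = ≡.trans (lookup-ofList-++ (map (λ t → j ⊕ suc t) (upTo k₁)) _ x)
    (≡.cong₂ _∨_ (≡.cong (λ ys → lookup (ofList ys) x) (List.map-cong (λ t → ≡.sym (⊕-⊕ j 1 t)) (upTo k₁)))
                 (≡.trans (lookup-ofList-[ j ⊕ (k ℕ.+ 1) ] x)
                          (≡.cong (λ y → does (x Fin.≟ y)) (≡.trans (≡.cong (j ⊕_) (ℕ.+-comm k 1)) (≡.sym (⊕-⊕ j 1 k))))))

  z∉I₁ : lookup I₁ z ≡ false
  z∉I₁ = ≡.trans (lookup-interval k₁ a (ℕ.<⇒≤ k₁<N) k₁<N) (dec-false (k₁ ℕ.<? k₁) (ℕ.n≮n k₁))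

  z⁺∉I₁ : lookup I₁ z⁺ ≡ false
  z⁺∉I₁ = ≡.trans (lookup-interval k₁ a (ℕ.<⇒≤ k₁<N) k<N) (dec-false (k ℕ.<? k₁) (ℕ.<-asym (ℕ.n<1+n k₁)))

  z≢z⁺ : z ≢ z⁺
  z≢z⁺ z≡z⁺ = ℕ.n≮n k₁ (≡.subst (k₁ <_) (≡.sym (⊕-injective a k₁<N k<N z≡z⁺)) (ℕ.n<1+n k₁))

  lookup-J-offset : ∀ {d} → d < N → lookup J (a ⊕ d) ≡ does (d ℕ.<? k)
  lookup-J-offset {d} d<N = ≡.trans (≡.cong (λ S → lookup S (a ⊕ d)) cyc≡interval) (lookup-interval k a (ℕ.<⇒≤ k<N) d<N)

  ∈J : ∀ {d} → d < k → lookup J (a ⊕ d) ≡ true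
  ∈J {d} d<k = ≡.trans (lookup-J-offset (ℕ.<-trans d<k k<N)) (dec-true (d ℕ.<? k) d<k)

  ∉J : ∀ {d} → k ≤ d → d < N → lookup J (a ⊕ d) ≡ false
  ∉J {d} k≤d d<N = ≡.trans (lookup-J-offset d<N) (dec-false (d ℕ.<? k) (ℕ.≤⇒≯ k≤d))

  z∈J : lookup J z ≡ true
  z∈J = ∈J (ℕ.n<1+n k₁)

  z⁺∉J : lookup J z⁺ ≡ false
  z⁺∉J = ∉J ℕ.≤-refl k<N

  IJ≡⁅z⁆ : IJ J ≡ ⁅ z ⁆
  IJ≡⁅z⁆ = lookup-ext at
    where
    right-end : ∀ d → d < N → lookup J (a ⊕ d) ∧ not (lookup J (a ⊕ suc d)) ≡ does (a ⊕ d Fin.≟ z)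
    right-end d d<N with ℕ.<-cmp d k₁
    ... | tri< d<k₁ _ _ = ≡.trans (≡.cong₂ (λ u v → u ∧ not v) (∈J (ℕ.m<n⇒m<1+n d<k₁)) (∈J (s≤s d<k₁)))
                                  (≡.sym (dec-false (a ⊕ d Fin.≟ z) (ℕ.<⇒≢ d<k₁ ∘ ⊕-injective a d<N k₁<N)))
    ... | tri≈ _ ≡.refl _ = ≡.trans (≡.cong₂ (λ u v → u ∧ not v) z∈J z⁺∉J) (≡.sym (dec-true (z Fin.≟ z) ≡.refl))
    ... | tri> _ _ k₁<d = ≡.trans (≡.cong (_∧ not (lookup J (a ⊕ suc d))) (∉J k₁<d d<N))
                                  (≡.sym (dec-false (a ⊕ d Fin.≟ z) (ℕ.<⇒≢ k₁<d ∘ ≡.sym ∘ ⊕-injective a d<N k₁<N)))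
    at : ∀ x → lookup (IJ J) x ≡ lookup ⁅ z ⁆ x
    at x with offset a x
    ... | d , d<N , ≡.refl = begin
      lookup (IJ J) (a ⊕ d)                                    ≡⟨ lookup-IJ J (a ⊕ d) ⟩
      lookup J (a ⊕ d) ∧ not (lookup J ((a ⊕ d) ⊕ 1))          ≡⟨ ≡.cong (λ y → lookup J (a ⊕ d) ∧ not (lookup J y)) (⊕-⊕1 a d) ⟩
      lookup J (a ⊕ d) ∧ not (lookup J (a ⊕ suc d))            ≡⟨ right-end d d<N ⟩
      does (a ⊕ d Fin.≟ z)                                     ≡⟨ ≡.sym (lookup-⁅⁆ z (a ⊕ d)) ⟩
      lookup ⁅ z ⁆ (a ⊕ d)                                     ∎
      where open ≡.≡-Reasoning

  1<N : 1 < N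
  1<N = ℕ.≤-trans (s≤s (s≤s z≤n)) k<N

  J-equation : ∀ i → e J i ≡ cubeVec J Subset.⊥ i
  J-equation i = ≡.sym (≡.trans (cubeVec-local J Subset.⊥ i)
    (≡.trans (≡.cong₂ (λ u v → e J i + (bit u - bit v)) (lookup-⊥ (prev i)) (lookup-⊥ i)) (ℤ.+-identityʳ (e J i))))

  G-equation : ∀ i → e G i ≡ cubeVec J ⁅ z ⁆ i
  G-equation i = ≡.trans (by-position i) (≡.sym (cubeVec-local J ⁅ z ⁆ i))
    where
    by-position : ∀ i → bit (lookup G i) ≡ bit (lookup J i) + (bit (lookup ⁅ z ⁆ (prev i)) - bit (lookup ⁅ z ⁆ i))
    by-position i rewrite lookup-⁅⁆ z (prev i) | lookup-⁅⁆ z i | lookup-G i | lookup-J i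
      with i Fin.≟ z | i Fin.≟ z⁺ | prev i Fin.≟ z
    ... | yes ≡.refl | yes z≡z⁺   | _            = contradiction z≡z⁺ z≢z⁺
    ... | yes ≡.refl | no _       | yes prev-z≡z = contradiction prev-z≡z (prev-≢ 1<N z)
    ... | yes ≡.refl | no _       | no _         rewrite z∉I₁ = ≡.refl
    ... | no _       | yes ≡.refl | no prev≢z    = contradiction (prev∘⊕suc a k₁) prev≢z
    ... | no _       | yes ≡.refl | yes _        rewrite z⁺∉I₁ = ≡.refl
    ... | no _       | no i≢z⁺    | yes prev-i≡z = contradiction (≡.trans (prev≡⇒≡⊕1 prev-i≡z) (⊕-⊕1 a k₁)) i≢z⁺
    ... | no _       | no _       | no _         = ≡.sym (ℤ.+-identityʳ _)

  InCube-J⇒ : ∀ M → InCube J M → M ≡ J ⊎ M ≡ G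
  InCube-J⇒ M J→M with Any.satisfied J→M
  ... | A , A⊆IJ , eM≡ with ⊆⁅⁆ z (≡.subst (A ⊆_) IJ≡⁅z⁆ A⊆IJ)
  ...   | inj₁ ≡.refl = inj₁ (lookup-ext λ i → bit-injective (≡.trans (eM≡ i) (≡.sym (J-equation i))))
  ...   | inj₂ ≡.refl = inj₂ (lookup-ext λ i → bit-injective (≡.trans (eM≡ i) (≡.sym (G-equation i))))

  InCube-J-J : InCube J J
  InCube-J-J = any-allSubsets Subset.⊥ (Subset.⊆-min (IJ J) , J-equation)

  InCube-J-G : InCube J G
  InCube-J-G = any-allSubsets ⁅ z ⁆ (Subset.⊆-reflexive (≡.sym IJ≡⁅z⁆) , G-equation)

  ∣J∣ : ∣ J ∣ ≡ k
  ∣J∣ = ≡.trans (≡.cong ∣_∣ cyc≡interval) (∣interval∣ k a (ℕ.<⇒≤ k<N))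

  ∣G∣ : ∣ G ∣ ≡ k
  ∣G∣ = ≡.trans (∣∣-insert {S = I₁} {G} z⁺ z⁺∉I₁ lookup-G) (≡.cong suc (∣interval∣ k₁ a (ℕ.<⇒≤ k₁<N)))

  J∩G≡I₁ : J ∩ G ≡ I₁
  J∩G≡I₁ = lookup-ext at
    where
    at : ∀ x → lookup (J ∩ G) x ≡ lookup I₁ x
    at x rewrite lookup-∩ J G x | lookup-J x | lookup-G x with x Fin.≟ z
    ... | yes ≡.refl rewrite z∉I₁ | dec-false (z Fin.≟ z⁺) z≢z⁺ = ≡.refl
    ... | no _ rewrite Bool.∨-identityʳ (lookup I₁ x) = Bool.∧-abs-∨ (lookup I₁ x) _

  J≢G : J ≢ G
  J≢G J≡G = contradiction (≡.trans (≡.sym z∈J) (≡.trans (≡.cong (λ S → lookup S z) J≡G) z∉G)) λ ()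
    where
    z∉G : lookup G z ≡ false
    z∉G = ≡.trans (lookup-G z) (≡.cong₂ _∨_ z∉I₁ (dec-false (z Fin.≟ z⁺) z≢z⁺))

  sgn-J-J : sgn k J J ≡ -1ℤ
  sgn-J-J = begin
    -1ℤ ℤ.^ (∣ J ∩ J ∣ ℕ.+ k ℕ.+ 1)   ≡⟨ ≡.cong (λ S → -1ℤ ℤ.^ (∣ S ∣ ℕ.+ k ℕ.+ 1)) (Subset.∩-idem J) ⟩
    -1ℤ ℤ.^ (∣ J ∣ ℕ.+ k ℕ.+ 1)       ≡⟨ ≡.cong (λ t → -1ℤ ℤ.^ (t ℕ.+ k ℕ.+ 1)) ∣J∣ ⟩
    -1ℤ ℤ.^ (k ℕ.+ k ℕ.+ 1)           ≡⟨ ≡.cong (-1ℤ ℤ.^_) (ℕ.+-comm (k ℕ.+ k) 1) ⟩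
    -1ℤ * -1ℤ ℤ.^ (k ℕ.+ k)           ≡⟨ ≡.cong (-1ℤ *_) (-1ℤ^-double k) ⟩
    -1ℤ                               ∎
    where open ≡.≡-Reasoning

  sgn-J-G : sgn k J G ≡ + 1
  sgn-J-G = begin
    -1ℤ ℤ.^ (∣ J ∩ G ∣ ℕ.+ k ℕ.+ 1)   ≡⟨ ≡.cong (λ S → -1ℤ ℤ.^ (∣ S ∣ ℕ.+ k ℕ.+ 1)) J∩G≡I₁ ⟩
    -1ℤ ℤ.^ (∣ I₁ ∣ ℕ.+ k ℕ.+ 1)      ≡⟨ ≡.cong (λ t → -1ℤ ℤ.^ (t ℕ.+ k ℕ.+ 1)) (∣interval∣ k₁ a (ℕ.<⇒≤ k₁<N)) ⟩
    -1ℤ ℤ.^ (k₁ ℕ.+ k ℕ.+ 1)          ≡⟨ ≡.cong (-1ℤ ℤ.^_) (ℕ.+-comm (k₁ ℕ.+ k) 1) ⟩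
    -1ℤ ℤ.^ (k ℕ.+ k)                 ≡⟨ -1ℤ^-double k ⟩
    + 1                               ∎
    where open ≡.≡-Reasoning

  cubeCoeff-cyc : ∀ M → cubeCoeff k J M ≡ 𝟙 (M ≟ˢ G) - 𝟙 (M ≟ˢ J)
  cubeCoeff-cyc M rewrite dec-true (∣ J ∣ ℕ.≟ k) ∣J∣ with inCube? J M
  ... | no ¬J→M = ≡.sym (≡.cong₂ _-_ (𝟙-no (M ≟ˢ G) λ { ≡.refl → ¬J→M InCube-J-G })
                                     (𝟙-no (M ≟ˢ J) λ { ≡.refl → ¬J→M InCube-J-J }))
  ... | yes J→M with InCube-J⇒ M J→M
  ...   | inj₁ ≡.refl = ≡.trans sgn-J-J (≡.sym (≡.cong₂ _-_ (𝟙-no (J ≟ˢ G) J≢G) (𝟙-yes (J ≟ˢ J) ≡.refl)))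
  ...   | inj₂ ≡.refl = ≡.trans sgn-J-G (≡.sym (≡.cong₂ _-_ (𝟙-yes (G ≟ˢ G) ≡.refl) (𝟙-no (G ≟ˢ J) (J≢G ∘ ≡.sym))))

cyc-injective : ∀ m k₁ → suc k₁ < suc m → Injective _≡_ _≡_ (cyc {suc m} (suc k₁))
cyc-injective m k₁ k<N {j} {j′} eq = ⊕-cancelʳ 1 (⊕-cancelʳ k₁ (⁅⁆-injective (begin
  ⁅ (j ⊕ 1) ⊕ k₁ ⁆       ≡⟨ ≡.sym (CyclicInterval.IJ≡⁅z⁆ m k₁ k<N j) ⟩
  IJ (cyc (suc k₁) j)    ≡⟨ ≡.cong IJ eq ⟩
  IJ (cyc (suc k₁) j′)   ≡⟨ CyclicInterval.IJ≡⁅z⁆ m k₁ k<N j′ ⟩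
  ⁅ (j′ ⊕ 1) ⊕ k₁ ⁆      ∎)))
  where
  open Cyclic m
  open ≡.≡-Reasoning

-- Exponents and monomials

exponent : ∀ {n} → ℕ → Subset n → Subset n → ℤ
exponent k J M = guard (does (∣ M ∣ ℕ.≟ k)) (guard (does (inCube? J M)) (sgn k J M))

nonCyclicExponent : ∀ {n} → ℕ → Subset n → Subset n → ℤ
nonCyclicExponent k J M = guard (does (∣ J ∣ ℕ.≟ k)) (guard (not (does (isCyclic? k J))) (exponent k J M))

cycGapExponent : ∀ {n} → ℕ → Subset n → ℤ
cycGapExponent {n} k M = ∑ (λ j → 𝟙 (M ≟ˢ cyc k j) - 𝟙 (M ≟ˢ gap k j)) (allFin n)

module ExponentIdentity (m k₁ : ℕ) (k<N : suc k₁ < suc (suc (suc m))) where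
  open Cyclic (suc (suc m))
  open Involution m using (∑-cubeCoeff≡0)
  module Interval = CyclicInterval (suc (suc m)) k₁ k<N

  k : ℕ
  k = suc k₁

  IsCyclic⇔ : ∀ J → IsCyclic k J ⇔ (∃ λ j → J ≡ cyc k j)
  IsCyclic⇔ J = mk⇔
    (λ { (a , J≡a) → prev a , ≡.trans J≡a (≡.sym (≡.trans (Interval.cyc≡interval (prev a)) (≡.cong (interval k) (⊕1∘prev a)))) })
    (λ { (j , J≡j) → j ⊕ 1 , ≡.trans J≡j (Interval.cyc≡interval j) })

  ∑-cyclic : ∀ (f : Subset N → ℤ) →
    ∑ (λ J → guard (does (isCyclic? k J)) (f J)) (allSubsets N) ≡ ∑ (λ j → f (cyc k j)) (allFin N)
  ∑-cyclic f = begin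
    ∑ (λ J → guard (does (isCyclic? k J)) (f J)) S
      ≡⟨ ∑-cong S (λ J → guard≡𝟙* (isCyclic? k J) (f J)) ⟩
    ∑ (λ J → 𝟙 (isCyclic? k J) * f J) S
      ≡⟨ ∑-cong S (λ J → ≡.cong (_* f J) (𝟙-cyclic J)) ⟩
    ∑ (λ J → ∑ (λ j → 𝟙 (J ≟ˢ cyc k j)) (allFin N) * f J) S
      ≡⟨ ∑-cong S (λ J → ≡.sym (∑-*ʳ (λ j → 𝟙 (J ≟ˢ cyc k j)) (f J) (allFin N))) ⟩
    ∑ (λ J → ∑ (λ j → 𝟙 (J ≟ˢ cyc k j) * f J) (allFin N)) S
      ≡⟨ ∑-swap _ S (allFin N) ⟩
    ∑ (λ j → ∑ (λ J → 𝟙 (J ≟ˢ cyc k j) * f J) S) (allFin N)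
      ≡⟨ ∑-cong (allFin N) (λ j → ∑-cong S (λ J → ≡.sym (guard≡𝟙* (J ≟ˢ cyc k j) (f J)))) ⟩
    ∑ (λ j → ∑ (λ J → guard (does (J ≟ˢ cyc k j)) (f J)) S) (allFin N)
      ≡⟨ ∑-cong (allFin N) (λ j → ∑-δ _≟ˢ_ S (allSubsets-enumerates N) (cyc k j) f) ⟩
    ∑ (λ j → f (cyc k j)) (allFin N)
      ∎
    where
    open ≡.≡-Reasoning
    S = allSubsets N
    𝟙-cyclic : ∀ J → 𝟙 (isCyclic? k J) ≡ ∑ (λ j → 𝟙 (J ≟ˢ cyc k j)) (allFin N)
    𝟙-cyclic J = 𝟙-image _≟ˢ_ (cyc-injective (suc (suc m)) k₁ k<N) J (isCyclic? k J) (IsCyclic⇔ J)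

  module _ (M : Subset N) where

    private
      signed : Subset N → ℤ
      signed J = guard (does (inCube? J M)) (sgn k J M)

      size-test : ∀ J {b} → does (∣ M ∣ ℕ.≟ k) ≡ b →
        nonCyclicExponent k J M ≡ guard (does (∣ J ∣ ℕ.≟ k)) (guard (not (does (isCyclic? k J))) (guard b (signed J)))
      size-test J = ≡.cong (λ b → guard (does (∣ J ∣ ℕ.≟ k)) (guard (not (does (isCyclic? k J))) (guard b (signed J))))

      guard-not : ∀ x y u → guard x (guard (not y) u) ≡ guard x u - guard y (guard x u)
      guard-not true  true  u = ≡.sym (ℤ.+-inverseʳ u)
      guard-not true  false u = ≡.sym (ℤ.+-identityʳ u)
      guard-not false true  u = ≡.refl
      guard-not false false u = ≡.refl

    nonCyclicExponent-∣M∣≢k : ∣ M ∣ ≢ k → ∀ J → nonCyclicExponent k J M ≡ + 0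
    nonCyclicExponent-∣M∣≢k ∣M∣≢k J = ≡.trans (size-test J (dec-false (∣ M ∣ ℕ.≟ k) ∣M∣≢k))
      (≡.trans (≡.cong (guard (does (∣ J ∣ ℕ.≟ k))) (guard-0 (not (does (isCyclic? k J))))) (guard-0 (does (∣ J ∣ ℕ.≟ k))))

    nonCyclicExponent-∣M∣≡k : ∣ M ∣ ≡ k → ∀ J →
      nonCyclicExponent k J M ≡ cubeCoeff k J M - guard (does (isCyclic? k J)) (cubeCoeff k J M)
    nonCyclicExponent-∣M∣≡k ∣M∣≡k J = ≡.trans (size-test J (dec-true (∣ M ∣ ℕ.≟ k) ∣M∣≡k))
      (guard-not (does (∣ J ∣ ℕ.≟ k)) (does (isCyclic? k J)) (signed J))

    cycGapExponent-∣M∣≢k : ∣ M ∣ ≢ k → cycGapExponent k M ≡ + 0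
    cycGapExponent-∣M∣≢k ∣M∣≢k = ∑-0 (allFin N) λ j →
      ≡.cong₂ _-_ (𝟙-no (M ≟ˢ cyc k j) (wrong-size (Interval.∣J∣ j))) (𝟙-no (M ≟ˢ gap k j) (wrong-size (Interval.∣G∣ j)))
      where
      wrong-size : ∀ {X} → ∣ X ∣ ≡ k → M ≢ X
      wrong-size ∣X∣≡k ≡.refl = ∣M∣≢k ∣X∣≡k

    ∑-nonCyclicExponent : ∑ (λ J → nonCyclicExponent k J M) (allSubsets N) ≡ cycGapExponent k M
    ∑-nonCyclicExponent with ∣ M ∣ ℕ.≟ k
    ... | no ∣M∣≢k = ≡.trans (∑-0 (allSubsets N) (nonCyclicExponent-∣M∣≢k ∣M∣≢k)) (≡.sym (cycGapExponent-∣M∣≢k ∣M∣≢k))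
    ... | yes ∣M∣≡k = begin
      ∑ (λ J → nonCyclicExponent k J M) S
        ≡⟨ ∑-cong S (nonCyclicExponent-∣M∣≡k ∣M∣≡k) ⟩
      ∑ (λ J → c J - guard (does (isCyclic? k J)) (c J)) S
        ≡⟨ ∑-+ c _ S ⟩
      ∑ c S + ∑ (λ J → - guard (does (isCyclic? k J)) (c J)) S
        ≡⟨ ≡.cong₂ _+_ (∑-cubeCoeff≡0 k M 0<∣M∣ ∣M∣<N) (≡.sym (∑-neg _ S)) ⟩
      + 0 + - ∑ (λ J → guard (does (isCyclic? k J)) (c J)) S
        ≡⟨ ℤ.+-identityˡ _ ⟩
      - ∑ (λ J → guard (does (isCyclic? k J)) (c J)) S
        ≡⟨ ≡.cong -_ (≡.trans (∑-cyclic c) (∑-cong (allFin N) (λ j → Interval.cubeCoeff-cyc j M))) ⟩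
      - ∑ (λ j → 𝟙 (M ≟ˢ gap k j) - 𝟙 (M ≟ˢ cyc k j)) (allFin N)
        ≡⟨ ∑-neg (λ j → 𝟙 (M ≟ˢ gap k j) - 𝟙 (M ≟ˢ cyc k j)) (allFin N) ⟩
      ∑ (λ j → - (𝟙 (M ≟ˢ gap k j) - 𝟙 (M ≟ˢ cyc k j))) (allFin N)
        ≡⟨ ∑-cong (allFin N) (λ j → ℤ-AbelianGroup.⁻¹-anti-homo‿- (𝟙 (M ≟ˢ gap k j)) (𝟙 (M ≟ˢ cyc k j))) ⟩
      cycGapExponent k M
        ∎
      where
      open ≡.≡-Reasoning
      S = allSubsets N
      c = λ J → cubeCoeff k J M
      0<∣M∣ : 0 < ∣ M ∣
      0<∣M∣ = ≡.subst (0 <_) (≡.sym ∣M∣≡k) (s≤s z≤n)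
      ∣M∣<N : ∣ M ∣ < N
      ∣M∣<N = ≡.subst (_< N) (≡.sym ∣M∣≡k) k<N

module MonomialExpansion {c ℓ} (G : AbelianGroup c ℓ) (n k : ℕ) (p : Subset n → AbelianGroup.Carrier G) where
  open AbelianGroup G hiding (_-_) renaming (_∙_ to _·_; ε to 1G; _⁻¹ to inv)
  open ListProduct G
  open import Relation.Binary.Reasoning.Setoid setoid

  monomial : (Subset n → ℤ) → Carrier
  monomial a = ∏ (λ M → p M ^ a M) (allSubsets n)

  monomial-cong : ∀ {a b} → (∀ M → a M ≡ b M) → monomial a ≈ monomial b
  monomial-cong a≗b = ∏-cong (allSubsets n) (λ M → reflexive (≡.cong (p M ^_) (a≗b M)))

  ∏-monomial : {A : Set} (a : A → Subset n → ℤ) (xs : List A) →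
    ∏ (λ x → monomial (a x)) xs ≈ monomial (λ M → ∑ (λ x → a x M) xs)
  ∏-monomial a xs = trans (∏-swap (λ x M → p M ^ a x M) xs (allSubsets n)) (∏-cong (allSubsets n) (λ M → ∏-^ (p M) (λ x → a x M) xs))

  monomial-· : ∀ a b → monomial a · monomial b ≈ monomial (λ M → a M + b M)
  monomial-· a b = trans (sym (∏-· _ _ (allSubsets n))) (∏-cong (allSubsets n) (λ M → sym (^-+ (p M) (a M) (b M))))

  monomial-inv : ∀ a → inv (monomial a) ≈ monomial (λ M → - a M)
  monomial-inv a = trans (∏-inv _ (allSubsets n)) (∏-cong (allSubsets n) (λ M → sym (^-neg (p M) (a M))))

  if-cong : ∀ b {x y} → x ≈ y → (if b then x else 1G) ≈ (if b then y else 1G)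
  if-cong true  x≈y = x≈y
  if-cong false _   = refl

  monomial-guard : ∀ b a → (if b then monomial a else 1G) ≈ monomial (λ M → guard b (a M))
  monomial-guard true  a = refl
  monomial-guard false a = sym (∏-1 (allSubsets n) (λ _ → refl))

  p≈monomial : ∀ X → p X ≈ monomial (λ M → 𝟙 (M ≟ˢ X))
  p≈monomial X = sym (begin
    ∏ (λ M → p M ^ 𝟙 (M ≟ˢ X)) (allSubsets n)      ≈⟨ ∏-cong (allSubsets n) at-X ⟩
    ∏ (λ M → p X ^ 𝟙 (M ≟ˢ X)) (allSubsets n)      ≈⟨ ∏-^ (p X) (λ M → 𝟙 (M ≟ˢ X)) (allSubsets n) ⟩
    p X ^ ∑ (λ M → 𝟙 (M ≟ˢ X)) (allSubsets n)      ≡⟨ ≡.cong (p X ^_) (allSubsets-enumerates n X) ⟩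
    p X · 1G                                        ≈⟨ identityʳ (p X) ⟩
    p X                                             ∎)
    where
    at-X : ∀ M → p M ^ 𝟙 (M ≟ˢ X) ≈ p X ^ 𝟙 (M ≟ˢ X)
    at-X M with M ≟ˢ X
    ... | yes ≡.refl = refl
    ... | no _       = refl

  uG≈monomial : ∀ J → uG G n k p J ≈ monomial (exponent k J)
  uG≈monomial J = begin
    ∏ (λ M → p M ^ sgn k J M) (cube n k J)
      ≈⟨ ∏-filter (inCube? J) (λ M → p M ^ sgn k J M) (kSubsets n k) ⟩
    ∏ (λ M → if does (inCube? J M) then p M ^ sgn k J M else 1G) (kSubsets n k)
      ≈⟨ ∏-filter (λ S → ∣ S ∣ ℕ.≟ k) _ (allSubsets n) ⟩
    ∏ (λ M → if does (∣ M ∣ ℕ.≟ k) then (if does (inCube? J M) then p M ^ sgn k J M else 1G) else 1G) (allSubsets n)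
      ≈⟨ ∏-cong (allSubsets n) (λ M → reflexive (guarded-power (does (∣ M ∣ ℕ.≟ k)) (does (inCube? J M)) (p M) (sgn k J M))) ⟩
    monomial (exponent k J) ∎
    where
    guarded-power : ∀ b₁ b₂ x s → (if b₁ then (if b₂ then x ^ s else 1G) else 1G) ≡ x ^ guard b₁ (guard b₂ s)
    guarded-power true  true  x s = ≡.refl
    guarded-power true  false x s = ≡.refl
    guarded-power false b₂    x s = ≡.refl

  ∏u≈monomial : prodG G (map (uG G n k p) (nonCyclic n k)) ≈ monomial (λ M → ∑ (λ J → nonCyclicExponent k J M) (allSubsets n))
  ∏u≈monomial = begin
    ∏ (uG G n k p) (nonCyclic n k)
      ≈⟨ ∏-filter (λ S → ¬? (isCyclic? k S)) (uG G n k p) (kSubsets n k) ⟩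
    ∏ (λ J → if not (does (isCyclic? k J)) then uG G n k p J else 1G) (kSubsets n k)
      ≈⟨ ∏-filter (λ S → ∣ S ∣ ℕ.≟ k) _ (allSubsets n) ⟩
    ∏ (λ J → if does (∣ J ∣ ℕ.≟ k) then (if not (does (isCyclic? k J)) then uG G n k p J else 1G) else 1G) (allSubsets n)
      ≈⟨ ∏-cong (allSubsets n) guarded ⟩
    ∏ (λ J → monomial (nonCyclicExponent k J)) (allSubsets n)
      ≈⟨ ∏-monomial (nonCyclicExponent k) (allSubsets n) ⟩
    monomial (λ M → ∑ (λ J → nonCyclicExponent k J M) (allSubsets n)) ∎
    where
    guarded : ∀ J → (if does (∣ J ∣ ℕ.≟ k) then (if not (does (isCyclic? k J)) then uG G n k p J else 1G) else 1G)
                    ≈ monomial (nonCyclicExponent k J)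
    guarded J = trans (if-cong x (if-cong y (uG≈monomial J))) (trans (if-cong x (monomial-guard y (exponent k J))) (monomial-guard x _))
      where
      x = does (∣ J ∣ ℕ.≟ k)
      y = not (does (isCyclic? k J))

  rhsG≈monomial : rhsG G n k p ≈ monomial (cycGapExponent k)
  rhsG≈monomial = begin
    ∏ (λ j → p (cyc k j) · inv (p (gap k j))) (allFin n)
      ≈⟨ ∏-cong (allFin n) (λ j → ∙-cong (p≈monomial (cyc k j)) (⁻¹-cong (p≈monomial (gap k j)))) ⟩
    ∏ (λ j → monomial (λ M → 𝟙 (M ≟ˢ cyc k j)) · inv (monomial (λ M → 𝟙 (M ≟ˢ gap k j)))) (allFin n)
      ≈⟨ ∏-cong (allFin n) (λ j → trans (∙-congˡ (monomial-inv (λ M → 𝟙 (M ≟ˢ gap k j))))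
                                         (monomial-· (λ M → 𝟙 (M ≟ˢ cyc k j)) _)) ⟩
    ∏ (λ j → monomial (λ M → 𝟙 (M ≟ˢ cyc k j) - 𝟙 (M ≟ˢ gap k j))) (allFin n)
      ≈⟨ ∏-monomial (λ j M → 𝟙 (M ≟ˢ cyc k j) - 𝟙 (M ≟ˢ gap k j)) (allFin n) ⟩
    monomial (cycGapExponent k) ∎

powZ≡* : ∀ x s → powZ ℤ.+-0-abelianGroup x s ≡ s * x
powZ≡* x (+ t)    = powN≡* t
  where
  powN≡* : ∀ t → powN ℤ.+-0-abelianGroup x t ≡ + t * x
  powN≡* zero    = ≡.sym (ℤ.*-zeroˡ x)
  powN≡* (suc t) = ≡.trans (≡.cong (_+_ x) (powN≡* t)) (≡.sym (ℤ.suc-* (+ t) x))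
powZ≡* x -[1+ t ] = ≡.trans (≡.cong -_ (powZ≡* x (+ suc t))) (ℤ.neg-distribˡ-* (+ suc t) x)

ut≡uG : ∀ n k J (π : Subset n → ℤ) → ut n k J π ≡ uG ℤ.+-0-abelianGroup n k π J
ut≡uG n k J π = ≡.cong sumℤ (List.map-cong (λ M → ≡.sym (powZ≡* (π M) (sgn k J M))) (cube n k J))

module _ (m k₁ : ℕ) (k<N : suc k₁ < suc (suc (suc m))) where

  private
    N k : ℕ
    N = suc (suc (suc m))
    k = suc k₁

  product-identity : ∀ {c ℓ} (G : AbelianGroup c ℓ) (p : Subset N → AbelianGroup.Carrier G) →
    AbelianGroup._≈_ G (prodG G (map (uG G N k p) (nonCyclic N k))) (rhsG G N k p)
  product-identity G p = begin
    prodG G (map (uG G N k p) (nonCyclic N k))                         ≈⟨ ∏u≈monomial ⟩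
    monomial (λ M → ∑ (λ J → nonCyclicExponent k J M) (allSubsets N))  ≈⟨ monomial-cong (ExponentIdentity.∑-nonCyclicExponent m k₁ k<N) ⟩
    monomial (cycGapExponent k)                                         ≈⟨ rhsG≈monomial ⟨
    rhsG G N k p                                                        ∎
    where
    open AbelianGroup G using (setoid)
    open import Relation.Binary.Reasoning.Setoid setoid
    open MonomialExpansion G N k p

  tropical-identity : ∀ (π : Subset N → ℤ) → H N k π ≡ sumℤ (map (λ J → ut N k J π) (nonCyclic N k))
  tropical-identity π = ≡.sym (≡.trans (≡.cong sumℤ (List.map-cong (λ J → ut≡uG N k J π) (nonCyclic N k)))
                                      (product-identity ℤ.+-0-abelianGroup π))

mainTheorem13 : ∀ {c ℓ} (n k : ℕ) → 2 ≤ k → k < n →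
    (∀ (G : AbelianGroup c ℓ) (p : Subset n → AbelianGroup.Carrier G) →
    AbelianGroup._≈_ G (prodG G (map (uG G n k p) (nonCyclic n k))) (rhsG G n k p))
    × (∀ (π : Subset n → ℤ) → H n k π ≡ sumℤ (map (λ J → ut n k J π) (nonCyclic n k)))
mainTheorem13 _ _ (s≤s (s≤s z≤n)) k<n@(s≤s (s≤s (s≤s _))) = product-identity _ _ k<n , tropical-identity _ _ k<n
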